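{- For a positive integer $s$ and a nonnegative integer $r$, \[ \sum_{D \in \mathcal{D}_{s,s}^{(r)}} q^{\mathrm{vmr}(D)} = q^{\binom{r+1}{2}}\begin{bmatrix} 2s-1\\ s+r\end{bmatrix}_q. \]
   Context: A Dyck path of length $2s$ is a sequence of lattice points $v_0=(0,0),v_1,\dots,v_{2s}=(2s,0)$ with each step $v_i-v_{i-1}\in\{(1,1),(1,-1)\}$, never going below the $x$-axis. A point $v_i$ ($0<i<2s$) is a valley if $v_i-v_{i-1}=(1,-1)$ and $v_{i+1}-v_i=(1,1)$; a valley on the $x$-axis is a return. Each return may independently be marked or not; $\mathcal{D}_{s,s}^{(r)}$ is the set of Dyck paths from $(0,0)$ to $(2s,0)$ together with a choice of marked returns, with at least $r$ marked returns. $\mathrm{maj}(D)$ is the sum of the $x$-coordinates of all valleys of $D$, and $\mathrm{vmr}(D)=\mathrm{maj}(D)-\frac12\sum x_i$, the latter sum over the $x$-coordinates of the marked returns. $\begin{bmatrix} n\\ k\end{bmatrix}_q=\frac{(q;q)_n}{(q;q)_k(q;q)_{n-k}}$ for $n\ge k\ge0$ and $0$ otherwise, $(q;q)_n=(1-q)\cdots(1-q^n)$. -}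

module Defs where

open import Data.Bool using (Bool; true; false; not; _∧_; if_then_else_; T)
open import Data.Nat as ℕ using (ℕ; zero; suc; _∸_; _≤_; _≤ᵇ_; _/_)
open import Data.Nat.Combinatorics using (_C_)
open import Data.Integer as ℤ using (ℤ; +_; _-_; _*_; _^_)
open import Data.List using (List; []; _∷_; map; concatMap; filterᵇ; foldr; upTo; take; length)
open import Data.Product using (_×_; _,_; proj₁; proj₂)
open import Relation.Binary.PropositionalEquality using (_≡_)
open import Relation.Nullary using (¬_)

-- A lattice path is a list of steps: true = up-step (1,1), false = down-step (1,-1).
-- Step number k (0-based) goes from v_k to v_{k+1}.

allLists : ℕ → List (List Bool)
allLists zero = [] ∷ []
allLists (suc n) = concatMap (λ w → (true ∷ w) ∷ (false ∷ w) ∷ []) (allLists n)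

dyckFrom : ℕ → List Bool → Bool
dyckFrom zero [] = true
dyckFrom (suc h) [] = false
dyckFrom h (true ∷ w) = dyckFrom (suc h) w
dyckFrom zero (false ∷ w) = false
dyckFrom (suc h) (false ∷ w) = dyckFrom h w

isDyck : List Bool → Bool
isDyck = dyckFrom 0

-- valleyAt w i : v_i is a valley, i.e. 0 < i, step i-1 is down and step i is up
valleyAt : List Bool → ℕ → Bool
valleyAt (x ∷ y ∷ w) (suc zero) = not x ∧ y
valleyAt (x ∷ w) (suc (suc i)) = valleyAt w (suc i)
valleyAt _ _ = false

stepVal : Bool → ℤ
stepVal true = + 1
stepVal false = ℤ.- (+ 1)

height : List Bool → ℕ → ℤ
height w i = foldr (λ b acc → stepVal b ℤ.+ acc) (+ 0) (take i w)

isZero : ℤ → Bool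
isZero (+ zero) = true
isZero _ = false

returnAt : List Bool → ℕ → Bool
returnAt w i = valleyAt w i ∧ isZero (height w i)

nth : List Bool → ℕ → Bool
nth [] _ = false
nth (b ∷ _) zero = b
nth (_ ∷ m) (suc i) = nth m i

sumℕ : List ℕ → ℕ
sumℕ = foldr ℕ._+_ 0

maj : List Bool → ℕ
maj w = sumℕ (map (λ i → if valleyAt w i then i else 0) (upTo (suc (length w))))

-- A marked Dyck path: (w , m) where m is a list of marks indexed by
-- x-coordinate 0..2s; only returns may be marked.
MarkedPath : Set
MarkedPath = List Bool × List Bool

marksValid : List Bool → List Bool → Bool
marksValid w m = foldr _∧_ true
  (map (λ i → if nth m i then returnAt w i else true) (upTo (length m)))

countMarks : List Bool → ℕ
countMarks m = sumℕ (map (λ b → if b then 1 else 0) m)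

-- half the sum of the x-coordinates of marked returns
-- (each return has even x-coordinate, so x / 2 is exact)
halfMarked : List Bool → ℕ
halfMarked m = sumℕ (map (λ i → if nth m i then i / 2 else 0) (upTo (length m)))

-- vmr(D) = maj(D) - ½ Σ (x-coords of marked returns)  (always ≥ 0)
vmr : MarkedPath → ℕ
vmr (w , m) = maj w ∸ halfMarked m

markedDyck : ℕ → ℕ → List MarkedPath
markedDyck s r =
  filterᵇ (λ D → isDyck (proj₁ D) ∧ marksValid (proj₁ D) (proj₂ D) ∧ (r ≤ᵇ countMarks (proj₂ D)))
    (concatMap (λ w → map (λ m → (w , m)) (allLists (suc (2 ℕ.* s)))) (allLists (2 ℕ.* s)))

vmrSum : ℕ → ℕ → ℤ → ℤ
vmrSum s r q = foldr ℤ._+_ (+ 0) (map (λ D → q ^ vmr D) (markedDyck s r))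

qPoch : ℤ → ℕ → ℤ
qPoch q zero = + 1
qPoch q (suc n) = qPoch q n * (+ 1 - q ^ suc n)

-- f equals c(q) · [n k]_q as polynomial functions of q, where
-- [n k]_q = (q;q)_n / ((q;q)_k (q;q)_{n-k}) for n ≥ k and 0 otherwise
-- (denominators cleared; the identity is required for every integer q).
EqScaledQBinom : (ℤ → ℤ) → (ℤ → ℤ) → ℕ → ℕ → Set
EqScaledQBinom f c n k =
  (k ≤ n → ∀ q → f q * qPoch q k * qPoch q (n ∸ k) ≡ c q * qPoch q n)
  × (¬ (k ≤ n) → ∀ q → f q ≡ + 0)

module Submission where

-- Build marked Dyck paths one step at a time. The weight q ^ vmr of a marked prefix depends only
-- on its final height, its last step and its marking: appending an up-step after a down-step
-- creates a valley at the current length n, adding n to maj, and marking that valley (possible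
-- only on the axis) subtracts n / 2. Hence the generating functions up n h r and down n h r of
-- prefixes of length n ending at height h with an up- resp. down-step and at least r marked
-- returns satisfy a linear recursion in n. It is solved by q-binomials: down (2d + h) h r equals
-- q ^ (r + 1 choose 2) times [2d + h - 1, d - 1 - r]_q, as one checks with both q-Pascal rules.
-- For d = s, h = 0 this is the claimed q ^ (r + 1 choose 2) [2s - 1, s + r]_q.

open import Defs
open import Relation.Binary.PropositionalEquality

module Sums where

  open import Data.Bool using (Bool; true; false)
  open import Data.Integer using (ℤ; +_; _+_; _*_)
  open import Data.Integer.Properties using (+-identityˡ; +-assoc; *-zeroʳ; *-distribˡ-+; +-commutativeSemigroup)
  open import Algebra.Properties.CommutativeSemigroup +-commutativeSemigroup using (interchange)
  open import Data.List using (List; []; _∷_; _++_; _∷ʳ_; map; concatMap; filterᵇ; foldr; length)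
  open import Data.List.Properties using (map-++)
  open import Data.Nat using (ℕ; zero; suc)
  open import Function using (_∘_)
  open ≡-Reasoning

  ind : Bool → ℤ → ℤ
  ind true  z = z
  ind false _ = + 0

  ind-0 : ∀ c → ind c (+ 0) ≡ + 0
  ind-0 true  = refl
  ind-0 false = refl

  sumℤ : List ℤ → ℤ
  sumℤ = foldr _+_ (+ 0)

  module _ {A : Set} where

    sumℤ-++ : (xs ys : List ℤ) → sumℤ (xs ++ ys) ≡ sumℤ xs + sumℤ ys
    sumℤ-++ []       ys = sym (+-identityˡ _)
    sumℤ-++ (x ∷ xs) ys = trans (cong (_+_ x) (sumℤ-++ xs ys)) (sym (+-assoc x _ _))

    sumℤ-map-+ : (f g : A → ℤ) (xs : List A) →
                 sumℤ (map (λ x → f x + g x) xs) ≡ sumℤ (map f xs) + sumℤ (map g xs)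
    sumℤ-map-+ f g []       = refl
    sumℤ-map-+ f g (x ∷ xs) =
      trans (cong (_+_ (f x + g x)) (sumℤ-map-+ f g xs)) (interchange (f x) (g x) _ _)

    sumℤ-map-* : (c : ℤ) (f : A → ℤ) (xs : List A) →
                 sumℤ (map (λ x → c * f x) xs) ≡ c * sumℤ (map f xs)
    sumℤ-map-* c f []       = sym (*-zeroʳ c)
    sumℤ-map-* c f (x ∷ xs) = trans (cong (_+_ (c * f x)) (sumℤ-map-* c f xs)) (sym (*-distribˡ-+ c _ _))

    sumℤ-map-0 : (xs : List A) → sumℤ (map (λ _ → + 0) xs) ≡ + 0
    sumℤ-map-0 []       = refl
    sumℤ-map-0 (x ∷ xs) = cong (_+_ (+ 0)) (sumℤ-map-0 xs)

    sumℤ-filterᵇ : (p : A → Bool) (f : A → ℤ) (xs : List A) →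
                   sumℤ (map f (filterᵇ p xs)) ≡ sumℤ (map (λ x → ind (p x) (f x)) xs)
    sumℤ-filterᵇ p f [] = refl
    sumℤ-filterᵇ p f (x ∷ xs) with p x
    ... | true  = cong (_+_ (f x)) (sumℤ-filterᵇ p f xs)
    ... | false = trans (sumℤ-filterᵇ p f xs) (sym (+-identityˡ _))

    sumℤ-concatMap : {B : Set} (f : B → ℤ) (g : A → List B) (xs : List A) →
                     sumℤ (map f (concatMap g xs)) ≡ sumℤ (map (sumℤ ∘ map f ∘ g) xs)
    sumℤ-concatMap f g []       = refl
    sumℤ-concatMap f g (x ∷ xs) = begin
      sumℤ (map f (g x ++ concatMap g xs))            ≡⟨ cong sumℤ (map-++ f (g x) _) ⟩
      sumℤ (map f (g x) ++ map f (concatMap g xs))    ≡⟨ sumℤ-++ (map f (g x)) _ ⟩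
      sumℤ (map f (g x)) + sumℤ (map f (concatMap g xs)) ≡⟨ cong (_+_ (sumℤ (map f (g x)))) (sumℤ-concatMap f g xs) ⟩
      sumℤ (map f (g x)) + sumℤ (map (sumℤ ∘ map f ∘ g) xs) ∎

  sumAll : ℕ → (List Bool → ℤ) → ℤ
  sumAll n f = sumℤ (map f (allLists n))

  sumAll-∷ : ∀ n f → sumAll (suc n) f ≡ sumAll n (λ w → f (true ∷ w) + f (false ∷ w))
  sumAll-∷ n f = go (allLists n)
    where
    go : ∀ ws → sumℤ (map f (concatMap (λ w → (true ∷ w) ∷ (false ∷ w) ∷ []) ws))
              ≡ sumℤ (map (λ w → f (true ∷ w) + f (false ∷ w)) ws)
    go []       = refl
    go (w ∷ ws) = trans (cong (λ s → f (true ∷ w) + (f (false ∷ w) + s)) (go ws))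
                        (sym (+-assoc (f (true ∷ w)) (f (false ∷ w)) _))

  sumAll-cong : ∀ n {f g : List Bool → ℤ} → (∀ w → length w ≡ n → f w ≡ g w) → sumAll n f ≡ sumAll n g
  sumAll-cong zero    f≗g = cong (_+ + 0) (f≗g [] refl)
  sumAll-cong (suc n) {f} {g} f≗g = begin
    sumAll (suc n) f                                   ≡⟨ sumAll-∷ n f ⟩
    sumAll n (λ w → f (true ∷ w) + f (false ∷ w))
      ≡⟨ sumAll-cong n (λ w ∣w∣ → cong₂ _+_ (f≗g _ (cong suc ∣w∣)) (f≗g _ (cong suc ∣w∣))) ⟩
    sumAll n (λ w → g (true ∷ w) + g (false ∷ w))      ≡⟨ sumAll-∷ n g ⟨
    sumAll (suc n) g ∎

  sumAll-+ : ∀ n f g → sumAll n (λ w → f w + g w) ≡ sumAll n f + sumAll n g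
  sumAll-+ n f g = sumℤ-map-+ f g (allLists n)

  sumAll-* : ∀ n c f → sumAll n (λ w → c * f w) ≡ c * sumAll n f
  sumAll-* n c f = sumℤ-map-* c f (allLists n)

  sumAll-∷ʳ : ∀ n f → sumAll (suc n) f ≡ sumAll n (λ w → f (w ∷ʳ true) + f (w ∷ʳ false))
  sumAll-∷ʳ zero    f = sym (+-assoc (f (true ∷ [])) (f (false ∷ [])) (+ 0))
  sumAll-∷ʳ (suc n) f = begin
    sumAll (suc (suc n)) f
      ≡⟨ trans (sumAll-∷ (suc n) f) (sumAll-∷ʳ n _) ⟩
    sumAll n (λ w → (f (true ∷ w ∷ʳ true) + f (false ∷ w ∷ʳ true)) + (f (true ∷ w ∷ʳ false) + f (false ∷ w ∷ʳ false)))
      ≡⟨ sumAll-cong n (λ w _ → interchange (f (true ∷ w ∷ʳ true)) (f (false ∷ w ∷ʳ true)) _ _) ⟩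
    sumAll n (λ w → (f (true ∷ w ∷ʳ true) + f (true ∷ w ∷ʳ false)) + (f (false ∷ w ∷ʳ true) + f (false ∷ w ∷ʳ false)))
      ≡⟨ sumAll-∷ n _ ⟨
    sumAll (suc n) (λ w → f (w ∷ʳ true) + f (w ∷ʳ false)) ∎

  sumAll² : ℕ → (List Bool → List Bool → ℤ) → ℤ
  sumAll² n g = sumAll n (λ w → sumAll n (g w))

  sumBool² : (Bool → Bool → ℤ) → ℤ
  sumBool² f = (f true true + f true false) + (f false true + f false false)

  sumBool²-cong : ∀ {f g : Bool → Bool → ℤ} → (∀ b x → f b x ≡ g b x) → sumBool² f ≡ sumBool² g
  sumBool²-cong f≗g = cong₂ _+_ (cong₂ _+_ (f≗g true true) (f≗g true false)) (cong₂ _+_ (f≗g false true) (f≗g false false))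

  sumAll²-∷ʳ : ∀ n g → sumAll² (suc n) g ≡ sumAll² n (λ w m → sumBool² (λ b x → g (w ∷ʳ b) (m ∷ʳ x)))
  sumAll²-∷ʳ n g = trans (sumAll-∷ʳ n _) (sumAll-cong n λ w _ →
    trans (cong₂ _+_ (sumAll-∷ʳ n _) (sumAll-∷ʳ n _)) (sym (sumAll-+ n _ _)))

  sumAll²-cong : ∀ n {g g′ : List Bool → List Bool → ℤ} →
                 (∀ w m → length w ≡ n → length m ≡ n → g w m ≡ g′ w m) → sumAll² n g ≡ sumAll² n g′
  sumAll²-cong n g≗g′ = sumAll-cong n λ w ∣w∣ → sumAll-cong n λ m ∣m∣ → g≗g′ w m ∣w∣ ∣m∣

  sumAll²-+ : ∀ n g g′ → sumAll² n (λ w m → g w m + g′ w m) ≡ sumAll² n g + sumAll² n g′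
  sumAll²-+ n g g′ = trans (sumAll-cong n λ w _ → sumAll-+ n (g w) (g′ w)) (sumAll-+ n _ _)

  sumAll²-* : ∀ n c g → sumAll² n (λ w m → c * g w m) ≡ c * sumAll² n g
  sumAll²-* n c g = trans (sumAll-cong n λ w _ → sumAll-* n c (g w)) (sumAll-* n c _)

  sumAll²-0 : ∀ n → sumAll² n (λ _ _ → + 0) ≡ + 0
  sumAll²-0 n = trans (sumAll-cong n λ w _ → sumℤ-map-0 (allLists n)) (sumℤ-map-0 (allLists n))

module QBinomial where

  open import Data.Integer using (ℤ; +_; _+_; _*_; _-_; _^_)
  open import Data.Integer.Properties using (+-comm; ^-distribˡ-+-*)
  open import Data.Integer.Tactic.RingSolver using (solve-∀)
  open import Data.Nat as ℕ using (ℕ; zero; suc)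
  import Data.Nat.Properties as ℕ
  open ≡-Reasoning

  module _ (q : ℤ) where

    -- qBinom a b is the Gaussian binomial [a + b, a]_q, indexed by the sizes of the two parts.
    qBinom : ℕ → ℕ → ℤ
    qBinom zero    b       = + 1
    qBinom (suc a) zero    = + 1
    qBinom (suc a) (suc b) = qBinom a (suc b) + q ^ suc a * qBinom (suc a) b

    qBinom-pascal′ : ∀ a b → qBinom (suc a) (suc b) ≡ q ^ suc b * qBinom a (suc b) + qBinom (suc a) b
    qBinom-pascal′ zero zero = ring q
      where
      ring : ∀ q → + 1 + q * + 1 * + 1 ≡ q * + 1 * + 1 + + 1
      ring = solve-∀
    qBinom-pascal′ zero (suc b) = begin
      + 1 + q ^ 1 * qBinom 1 (suc b)                   ≡⟨ cong (λ x → + 1 + q ^ 1 * x) (qBinom-pascal′ zero b) ⟩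
      + 1 + q ^ 1 * (q ^ suc b * + 1 + qBinom 1 b)     ≡⟨ ring q (q ^ b) (qBinom 1 b) ⟩
      q ^ suc (suc b) * + 1 + (+ 1 + q ^ 1 * qBinom 1 b) ∎
      where
      ring : ∀ q x y → + 1 + q * + 1 * (q * x * + 1 + y) ≡ q * (q * x) * + 1 + (+ 1 + q * + 1 * y)
      ring = solve-∀
    qBinom-pascal′ (suc a) zero = begin
      qBinom (suc a) 1 + q ^ suc (suc a) * + 1         ≡⟨ cong (λ x → x + q ^ suc (suc a) * + 1) (qBinom-pascal′ a zero) ⟩
      q ^ 1 * qBinom a 1 + + 1 + q ^ suc (suc a) * + 1 ≡⟨ ring q (q ^ a) (qBinom a 1) ⟩
      q ^ 1 * (qBinom a 1 + q ^ suc a * + 1) + + 1 ∎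
      where
      ring : ∀ q x y → q * + 1 * y + + 1 + q * (q * x) * + 1 ≡ q * + 1 * (y + q * x * + 1) + + 1
      ring = solve-∀
    qBinom-pascal′ (suc a) (suc b) = begin
      qBinom (suc a) (suc (suc b)) + q ^ suc (suc a) * qBinom (suc (suc a)) (suc b)
        ≡⟨ cong₂ (λ x y → x + q ^ suc (suc a) * y) (qBinom-pascal′ a (suc b)) (qBinom-pascal′ (suc a) b) ⟩
      (q ^ suc (suc b) * qBinom a (suc (suc b)) + qBinom (suc a) (suc b))
        + q ^ suc (suc a) * (q ^ suc b * qBinom (suc a) (suc b) + qBinom (suc (suc a)) b)
        ≡⟨ ring q (q ^ a) (q ^ b) (qBinom a (suc (suc b))) (qBinom (suc a) (suc b)) (qBinom (suc (suc a)) b) ⟩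
      q ^ suc (suc b) * (qBinom a (suc (suc b)) + q ^ suc a * qBinom (suc a) (suc b))
        + (qBinom (suc a) (suc b) + q ^ suc (suc a) * qBinom (suc (suc a)) b) ∎
      where
      ring : ∀ q qᵃ qᵇ x y z →
        (q * (q * qᵇ) * x + y) + q * (q * qᵃ) * (q * qᵇ * y + z)
        ≡ q * (q * qᵇ) * (x + q * qᵃ * y) + (y + q * (q * qᵃ) * z)
      ring = solve-∀

    qBinom-sym : ∀ a b → qBinom a b ≡ qBinom b a
    qBinom-sym zero    zero    = refl
    qBinom-sym zero    (suc b) = refl
    qBinom-sym (suc a) zero    = refl
    qBinom-sym (suc a) (suc b) = begin
      qBinom a (suc b) + q ^ suc a * qBinom (suc a) b
        ≡⟨ cong₂ (λ x y → x + q ^ suc a * y) (qBinom-sym a (suc b)) (qBinom-sym (suc a) b) ⟩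
      qBinom (suc b) a + q ^ suc a * qBinom b (suc a) ≡⟨ +-comm (qBinom (suc b) a) _ ⟩
      q ^ suc a * qBinom b (suc a) + qBinom (suc b) a ≡⟨ qBinom-pascal′ b a ⟨
      qBinom (suc b) (suc a) ∎

    qBinom-qPoch : ∀ a b → qBinom a b * qPoch q a * qPoch q b ≡ qPoch q (a ℕ.+ b)
    qBinom-qPoch zero b = ring (qPoch q b)
      where
      ring : ∀ x → + 1 * + 1 * x ≡ x
      ring = solve-∀
    qBinom-qPoch (suc a) zero = trans (ring (qPoch q (suc a))) (cong (qPoch q) (sym (ℕ.+-identityʳ (suc a))))
      where
      ring : ∀ x → + 1 * x * + 1 ≡ x
      ring = solve-∀
    qBinom-qPoch (suc a) (suc b) = begin
      (qBinom a (suc b) + qᵃ * qBinom (suc a) b) * (P a * (+ 1 - qᵃ)) * (P b * (+ 1 - qᵇ))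
        ≡⟨ ring₁ (qBinom a (suc b)) (qBinom (suc a) b) (P a) (P b) qᵃ qᵇ ⟩
      (+ 1 - qᵃ) * (qBinom a (suc b) * P a * P (suc b)) + qᵃ * (+ 1 - qᵇ) * (qBinom (suc a) b * P (suc a) * P b)
        ≡⟨ cong₂ (λ x y → (+ 1 - qᵃ) * x + qᵃ * (+ 1 - qᵇ) * y)
                 (qBinom-qPoch a (suc b)) (trans (qBinom-qPoch (suc a) b) (cong P (sym (ℕ.+-suc a b)))) ⟩
      (+ 1 - qᵃ) * P (a ℕ.+ suc b) + qᵃ * (+ 1 - qᵇ) * P (a ℕ.+ suc b)
        ≡⟨ ring₂ (P (a ℕ.+ suc b)) qᵃ qᵇ ⟩
      P (a ℕ.+ suc b) * (+ 1 - qᵃ * qᵇ)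
        ≡⟨ cong (λ x → P (a ℕ.+ suc b) * (+ 1 - x)) (^-distribˡ-+-* q (suc a) (suc b)) ⟨
      P (suc a ℕ.+ suc b) ∎
      where
      P = qPoch q
      qᵃ = q ^ suc a
      qᵇ = q ^ suc b
      ring₁ : ∀ x y pᵃ pᵇ qᵃ qᵇ →
        (x + qᵃ * y) * (pᵃ * (+ 1 - qᵃ)) * (pᵇ * (+ 1 - qᵇ))
        ≡ (+ 1 - qᵃ) * (x * pᵃ * (pᵇ * (+ 1 - qᵇ))) + qᵃ * (+ 1 - qᵇ) * (y * (pᵃ * (+ 1 - qᵃ)) * pᵇ)
      ring₁ = solve-∀
      ring₂ : ∀ p qᵃ qᵇ → (+ 1 - qᵃ) * p + qᵃ * (+ 1 - qᵇ) * p ≡ p * (+ 1 - qᵃ * qᵇ)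
      ring₂ = solve-∀

module Lists where

  open import Data.Bool using (Bool; _∧_)
  open import Data.Bool.Properties using (∧-assoc; ∧-identityʳ)
  open import Data.List using (List; []; _∷_; _∷ʳ_; map; take; length; upTo)
  open import Data.Bool.ListAction using (and)
  open import Data.List.Properties using (map-++; upTo-∷ʳ)
  open import Data.Nat using (ℕ; zero; suc; _+_; _≤_; _<_; s≤s)
  open import Data.Nat.ListAction using (sum)
  open import Data.Nat.ListAction.Properties using (sum-++)
  open import Data.Nat.Properties using (+-identityʳ; ≤-refl; m≤n⇒m≤1+n)
  open ≡-Reasoning

  length-∷ʳ : ∀ {A : Set} (xs : List A) x → length (xs ∷ʳ x) ≡ suc (length xs)
  length-∷ʳ []       x = refl
  length-∷ʳ (_ ∷ xs) x = cong suc (length-∷ʳ xs x)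

  take-∷ʳ : ∀ (w : List Bool) b {i} → i ≤ length w → take i (w ∷ʳ b) ≡ take i w
  take-∷ʳ w       b {zero}  _         = refl
  take-∷ʳ (c ∷ w) b {suc i} (s≤s i≤n) = cong (c ∷_) (take-∷ʳ w b i≤n)

  module _ {A : Set} where

    map-upTo-suc : ∀ (f : ℕ → A) n → map f (upTo (suc n)) ≡ map f (upTo n) ∷ʳ f n
    map-upTo-suc f n = trans (cong (map f) (sym (upTo-∷ʳ n))) (map-++ f (upTo n) (n ∷ []))

    map-upTo-cong : ∀ {f g : ℕ → A} n → (∀ i → i < n → f i ≡ g i) → map f (upTo n) ≡ map g (upTo n)
    map-upTo-cong zero    f≗g = refl
    map-upTo-cong {f} {g} (suc n) f≗g = begin
      map f (upTo (suc n))      ≡⟨ map-upTo-suc f n ⟩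
      map f (upTo n) ∷ʳ f n     ≡⟨ cong₂ _∷ʳ_ (map-upTo-cong n λ i i<n → f≗g i (m≤n⇒m≤1+n i<n)) (f≗g n ≤-refl) ⟩
      map g (upTo n) ∷ʳ g n     ≡⟨ map-upTo-suc g n ⟨
      map g (upTo (suc n)) ∎

    map-upTo-length-∷ʳ : ∀ (f : ℕ → A) {B : Set} (xs : List B) x →
                         map f (upTo (length (xs ∷ʳ x))) ≡ map f (upTo (length xs)) ∷ʳ f (length xs)
    map-upTo-length-∷ʳ f xs x = trans (cong (λ n → map f (upTo n)) (length-∷ʳ xs x)) (map-upTo-suc f (length xs))

  sum-∷ʳ : ∀ ns n → sum (ns ∷ʳ n) ≡ sum ns + n
  sum-∷ʳ ns n = trans (sum-++ ns (n ∷ [])) (cong (_+_ (sum ns)) (+-identityʳ n))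

  and-∷ʳ : ∀ bs b → and (bs ∷ʳ b) ≡ and bs ∧ b
  and-∷ʳ []       b = ∧-identityʳ b
  and-∷ʳ (c ∷ bs) b = trans (cong (c ∧_) (and-∷ʳ bs b)) (sym (∧-assoc c _ b))

module Paths where

  open import Data.Bool using (Bool; true; false; not; _∧_; if_then_else_)
  open import Data.Bool.Properties using (∧-zeroʳ; ∧-comm)
  open import Data.Integer as ℤ using (ℤ; +_)
  import Data.Integer.Properties as ℤ
  open import Data.Integer.Tactic.RingSolver using (solve-∀)
  open import Data.List using (List; []; _∷_; _∷ʳ_; map; foldr; length; upTo)
  open import Data.Bool.ListAction using (and)
  open import Data.List.Properties using (map-++; take-all)
  open import Data.Maybe using (Maybe; just; nothing; _>>=_)
  open import Data.Nat using (ℕ; zero; suc; _+_; _≤_; _<_; _/_; _≡ᵇ_; z≤n; s≤s)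
  open import Data.Nat.DivMod using (m/n≤m)
  open import Data.Nat.ListAction using (sum)
  open import Data.Nat.Properties using (+-identityʳ; ≤-refl; ≤-reflexive; ≤-trans; <⇒≤; <-≤-trans; +-mono-≤)
  open ≡-Reasoning
  open Lists

  step : Bool → ℕ → Maybe ℕ
  step true  h       = just (suc h)
  step false zero    = nothing
  step false (suc h) = just h

  endHeight : ℕ → List Bool → Maybe ℕ
  endHeight h []      = just h
  endHeight h (b ∷ w) = step b h >>= λ h′ → endHeight h′ w

  endsAt : Maybe ℕ → ℕ → Bool
  endsAt nothing  h = false
  endsAt (just k) h = k ≡ᵇ h

  endHeight-∷ʳ : ∀ h w b → endHeight h (w ∷ʳ b) ≡ (endHeight h w >>= step b)
  endHeight-∷ʳ h [] b with step b h
  ... | nothing = refl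
  ... | just h′ = refl
  endHeight-∷ʳ h (c ∷ w) b with step c h
  ... | nothing = refl
  ... | just h′ = endHeight-∷ʳ h′ w b

  endsAt-step-up : ∀ e h → endsAt (e >>= step true) (suc h) ≡ endsAt e h
  endsAt-step-up nothing  h = refl
  endsAt-step-up (just k) h = refl

  endsAt-step-down : ∀ e h → endsAt (e >>= step false) h ≡ endsAt e (suc h)
  endsAt-step-down nothing        h = refl
  endsAt-step-down (just zero)    h = refl
  endsAt-step-down (just (suc k)) h = refl

  dyckFrom-endHeight : ∀ h w → dyckFrom h w ≡ endsAt (endHeight h w) 0
  dyckFrom-endHeight zero    []          = refl
  dyckFrom-endHeight (suc h) []          = refl
  dyckFrom-endHeight zero    (true ∷ w)  = dyckFrom-endHeight 1 w
  dyckFrom-endHeight (suc h) (true ∷ w)  = dyckFrom-endHeight (suc (suc h)) w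
  dyckFrom-endHeight zero    (false ∷ w) = refl
  dyckFrom-endHeight (suc h) (false ∷ w) = dyckFrom-endHeight h w

  -- The empty path counts as ending with an up-step, so that no valley arises at x = 0.
  lastStep : List Bool → Bool
  lastStep []          = true
  lastStep (b ∷ [])    = b
  lastStep (_ ∷ c ∷ w) = lastStep (c ∷ w)

  lastStep-∷ʳ : ∀ w b → lastStep (w ∷ʳ b) ≡ b
  lastStep-∷ʳ []          b = refl
  lastStep-∷ʳ (_ ∷ [])    b = refl
  lastStep-∷ʳ (_ ∷ c ∷ w) b = lastStep-∷ʳ (c ∷ w) b

  dyckFrom-lastStep : ∀ h b w → dyckFrom h (b ∷ w) ≡ true → lastStep (b ∷ w) ≡ false
  dyckFrom-lastStep (suc h) false []      _    = refl
  dyckFrom-lastStep zero    true  (c ∷ w) dyck = dyckFrom-lastStep 1 c w dyck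
  dyckFrom-lastStep (suc h) true  (c ∷ w) dyck = dyckFrom-lastStep (suc (suc h)) c w dyck
  dyckFrom-lastStep (suc h) false (c ∷ w) dyck = dyckFrom-lastStep h c w dyck

  heightSum : List Bool → ℤ
  heightSum = foldr (λ b acc → stepVal b ℤ.+ acc) (+ 0)

  endHeight-heightSum : ∀ h w {k} → endHeight h w ≡ just k → + h ℤ.+ heightSum w ≡ + k
  endHeight-heightSum h       []          refl = ℤ.+-identityʳ (+ h)
  endHeight-heightSum h       (true ∷ w)  e    = trans (ring (+ h) (heightSum w)) (endHeight-heightSum (suc h) w e)
    where
    ring : ∀ x s → x ℤ.+ (+ 1 ℤ.+ s) ≡ (+ 1 ℤ.+ x) ℤ.+ s
    ring = solve-∀
  endHeight-heightSum (suc h) (false ∷ w) e    = trans (ring (+ h) (heightSum w)) (endHeight-heightSum h w e)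
    where
    ring : ∀ x s → (+ 1 ℤ.+ x) ℤ.+ (ℤ.- (+ 1) ℤ.+ s) ≡ x ℤ.+ s
    ring = solve-∀

  height-length : ∀ w {k} → endHeight 0 w ≡ just k → height w (length w) ≡ + k
  height-length w e =
    trans (cong heightSum (take-all (length w) w ≤-refl))
          (trans (sym (ℤ.+-identityˡ (heightSum w))) (endHeight-heightSum 0 w e))

  isZero-height-length : ∀ w {k} → endHeight 0 w ≡ just k → isZero (height w (length w)) ≡ endsAt (endHeight 0 w) 0
  isZero-height-length w {k} e rewrite height-length w e | e = isZero-+ k
    where
    isZero-+ : ∀ k → isZero (+ k) ≡ (k ≡ᵇ 0)
    isZero-+ zero    = refl
    isZero-+ (suc _) = refl

  height-∷ʳ : ∀ w b {i} → i ≤ length w → height (w ∷ʳ b) i ≡ height w i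
  height-∷ʳ w b i≤n = cong heightSum (take-∷ʳ w b i≤n)

  valley : Bool → Bool → Bool
  valley previous next = next ∧ not previous

  valleyAt-zero : ∀ w → valleyAt w 0 ≡ false
  valleyAt-zero []          = refl
  valleyAt-zero (_ ∷ [])    = refl
  valleyAt-zero (_ ∷ _ ∷ _) = refl

  valleyAt-length : ∀ w → valleyAt w (length w) ≡ false
  valleyAt-length []              = refl
  valleyAt-length (_ ∷ [])        = refl
  valleyAt-length (_ ∷ c ∷ w)     = valleyAt-length (c ∷ w)

  valleyAt-∷ʳ : ∀ w b {i} → i < length w → valleyAt (w ∷ʳ b) i ≡ valleyAt w i
  valleyAt-∷ʳ w           b {zero}        _               = trans (valleyAt-zero (w ∷ʳ b)) (sym (valleyAt-zero w))
  valleyAt-∷ʳ (_ ∷ _ ∷ _) b {suc zero}    _               = refl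
  valleyAt-∷ʳ (_ ∷ [])    b {suc _}       (s≤s ())
  valleyAt-∷ʳ (_ ∷ c ∷ w) b {suc (suc i)} (s≤s i<n)       = valleyAt-∷ʳ (c ∷ w) b i<n

  valleyAt-∷ʳ-length : ∀ w b → valleyAt (w ∷ʳ b) (length w) ≡ valley (lastStep w) b
  valleyAt-∷ʳ-length []          b = sym (∧-zeroʳ b)
  valleyAt-∷ʳ-length (a ∷ [])    b = ∧-comm (not a) b
  valleyAt-∷ʳ-length (_ ∷ c ∷ w) b = valleyAt-∷ʳ-length (c ∷ w) b

  valleyTerm : List Bool → ℕ → ℕ
  valleyTerm w i = if valleyAt w i then i else 0

  maj-length : ∀ w → maj w ≡ sum (map (valleyTerm w) (upTo (length w)))
  maj-length w = begin
    sum (map (valleyTerm w) (upTo (suc n)))                        ≡⟨ cong sum (map-upTo-suc (valleyTerm w) n) ⟩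
    sum (map (valleyTerm w) (upTo n) ∷ʳ valleyTerm w n)             ≡⟨ sum-∷ʳ (map (valleyTerm w) (upTo n)) (valleyTerm w n) ⟩
    sum (map (valleyTerm w) (upTo n)) + valleyTerm w n
      ≡⟨ cong (λ v → sum (map (valleyTerm w) (upTo n)) + (if v then n else 0)) (valleyAt-length w) ⟩
    sum (map (valleyTerm w) (upTo n)) + 0                           ≡⟨ +-identityʳ _ ⟩
    sum (map (valleyTerm w) (upTo n)) ∎
    where n = length w

  maj-∷ʳ : ∀ w b → maj (w ∷ʳ b) ≡ maj w + (if valley (lastStep w) b then length w else 0)
  maj-∷ʳ w b = begin
    maj (w ∷ʳ b)                                                       ≡⟨ maj-length (w ∷ʳ b) ⟩
    sum (map (valleyTerm (w ∷ʳ b)) (upTo (length (w ∷ʳ b))))           ≡⟨ cong sum (map-upTo-length-∷ʳ (valleyTerm (w ∷ʳ b)) w b) ⟩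
    sum (map (valleyTerm (w ∷ʳ b)) (upTo n) ∷ʳ valleyTerm (w ∷ʳ b) n)  ≡⟨ sum-∷ʳ (map (valleyTerm (w ∷ʳ b)) (upTo n)) _ ⟩
    sum (map (valleyTerm (w ∷ʳ b)) (upTo n)) + valleyTerm (w ∷ʳ b) n
      ≡⟨ cong₂ _+_ (cong sum (map-upTo-cong n λ i i<n → cong (λ v → if v then i else 0) (valleyAt-∷ʳ w b i<n)))
                   (cong (λ v → if v then n else 0) (valleyAt-∷ʳ-length w b)) ⟩
    sum (map (valleyTerm w) (upTo n)) + (if valley (lastStep w) b then n else 0)
      ≡⟨ cong (_+ (if valley (lastStep w) b then n else 0)) (maj-length w) ⟨
    maj w + (if valley (lastStep w) b then n else 0) ∎
    where n = length w

  returnAt-length : ∀ w → returnAt w (length w) ≡ false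
  returnAt-length w = cong (_∧ isZero (height w (length w))) (valleyAt-length w)

  returnAt-∷ʳ : ∀ w b {i} → i < length w → returnAt (w ∷ʳ b) i ≡ returnAt w i
  returnAt-∷ʳ w b i<n = cong₂ (λ v z → v ∧ isZero z) (valleyAt-∷ʳ w b i<n) (height-∷ʳ w b (<⇒≤ i<n))

  returnAt-∷ʳ-length : ∀ w b → returnAt (w ∷ʳ b) (length w) ≡ valley (lastStep w) b ∧ isZero (height w (length w))
  returnAt-∷ʳ-length w b = cong₂ (λ v z → v ∧ isZero z) (valleyAt-∷ʳ-length w b) (height-∷ʳ w b ≤-refl)

  nth-∷ʳ : ∀ m x {i} → i < length m → nth (m ∷ʳ x) i ≡ nth m i
  nth-∷ʳ (_ ∷ m) x {zero}  _         = refl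
  nth-∷ʳ (_ ∷ m) x {suc i} (s≤s i<n) = nth-∷ʳ m x i<n

  nth-∷ʳ-length : ∀ m x → nth (m ∷ʳ x) (length m) ≡ x
  nth-∷ʳ-length []      x = refl
  nth-∷ʳ-length (_ ∷ m) x = nth-∷ʳ-length m x

  markAllowed : List Bool → List Bool → ℕ → Bool
  markAllowed w m i = if nth m i then returnAt w i else true

  marksValid-∷ʳ : ∀ w m x → marksValid w (m ∷ʳ x) ≡ marksValid w m ∧ (if x then returnAt w (length m) else true)
  marksValid-∷ʳ w m x = begin
    and (map (markAllowed w (m ∷ʳ x)) (upTo (length (m ∷ʳ x))))             ≡⟨ cong and (map-upTo-length-∷ʳ _ m x) ⟩
    and (map (markAllowed w (m ∷ʳ x)) (upTo n) ∷ʳ markAllowed w (m ∷ʳ x) n) ≡⟨ and-∷ʳ (map (markAllowed w (m ∷ʳ x)) (upTo n)) _ ⟩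
    and (map (markAllowed w (m ∷ʳ x)) (upTo n)) ∧ markAllowed w (m ∷ʳ x) n
      ≡⟨ cong₂ _∧_ (cong and (map-upTo-cong n λ i i<n → cong (λ c → if c then returnAt w i else true) (nth-∷ʳ m x i<n)))
                   (cong (λ c → if c then returnAt w n else true) (nth-∷ʳ-length m x)) ⟩
    marksValid w m ∧ (if x then returnAt w n else true) ∎
    where n = length m

  marksValid-∷ʳ-path : ∀ w b m → length m ≤ length w → marksValid (w ∷ʳ b) m ≡ marksValid w m
  marksValid-∷ʳ-path w b m m≤w = cong and (map-upTo-cong (length m) λ i i<m →
    cong (λ c → if nth m i then c else true) (returnAt-∷ʳ w b (<-≤-trans i<m m≤w)))

  countMarks-∷ʳ : ∀ m x → countMarks (m ∷ʳ x) ≡ countMarks m + (if x then 1 else 0)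
  countMarks-∷ʳ m x = trans (cong sum (map-++ _ m (x ∷ []))) (sum-∷ʳ (map (λ b → if b then 1 else 0) m) _)

  halfTerm : List Bool → ℕ → ℕ
  halfTerm m i = if nth m i then i / 2 else 0

  halfMarked-∷ʳ : ∀ m x → halfMarked (m ∷ʳ x) ≡ halfMarked m + (if x then length m / 2 else 0)
  halfMarked-∷ʳ m x = begin
    sum (map (halfTerm (m ∷ʳ x)) (upTo (length (m ∷ʳ x))))          ≡⟨ cong sum (map-upTo-length-∷ʳ _ m x) ⟩
    sum (map (halfTerm (m ∷ʳ x)) (upTo n) ∷ʳ halfTerm (m ∷ʳ x) n)   ≡⟨ sum-∷ʳ (map (halfTerm (m ∷ʳ x)) (upTo n)) _ ⟩
    sum (map (halfTerm (m ∷ʳ x)) (upTo n)) + halfTerm (m ∷ʳ x) n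
      ≡⟨ cong₂ _+_ (cong sum (map-upTo-cong n λ i i<n → cong (λ c → if c then i / 2 else 0) (nth-∷ʳ m x i<n)))
                   (cong (λ c → if c then n / 2 else 0) (nth-∷ʳ-length m x)) ⟩
    halfMarked m + (if x then n / 2 else 0) ∎
    where n = length m

  -- Every marked point is a valley, and i / 2 ≤ i.
  halfMarked≤maj : ∀ w m → length m ≡ length w → marksValid w m ≡ true → halfMarked m ≤ maj w
  halfMarked≤maj w m ∣m∣≡∣w∣ valid =
    ≤-trans (termwise (upTo (length m)) valid)
            (≤-reflexive (trans (cong (λ n → sum (map (valleyTerm w) (upTo n))) ∣m∣≡∣w∣) (sym (maj-length w))))
    where
    termwise : ∀ is → and (map (markAllowed w m) is) ≡ true → sum (map (halfTerm m) is) ≤ sum (map (valleyTerm w) is)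
    termwise []       _  = z≤n
    termwise (i ∷ is) ok with nth m i | valleyAt w i | isZero (height w i) | ok
    ... | false | _    | _    | ok′ = +-mono-≤ z≤n (termwise is ok′)
    ... | true  | true | true | ok′ = +-mono-≤ (m/n≤m i 2) (termwise is ok′)

  record Stats : Set where
    constructor stats
    field
      end      : Maybe ℕ
      lastUp   : Bool
      valid    : Bool
      marks    : ℕ
      majIndex : ℕ
      half     : ℕ

  open Stats public

  statsOf : List Bool → List Bool → Stats
  statsOf w m = stats (endHeight 0 w) (lastStep w) (marksValid w m) (countMarks m) (maj w) (halfMarked m)

  -- Append a step b to a prefix whose last vertex has x-coordinate n, marking that vertex iff x.
  extend : Stats → ℕ → Bool → Bool → Stats
  extend S n b x = stats
    (end S >>= step b)
    b
    (valid S ∧ (if x then valley (lastUp S) b ∧ endsAt (end S) 0 else true))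
    (marks S + (if x then 1 else 0))
    (majIndex S + (if valley (lastUp S) b then n else 0))
    (half S + (if x then n / 2 else 0))

  Sound : Stats → Set
  Sound S = valid S ≡ true → half S ≤ majIndex S

  statsOf-∷ʳ : ∀ w m b x {k} → endHeight 0 w ≡ just k → length m ≡ length w →
               statsOf (w ∷ʳ b) (m ∷ʳ x) ≡ extend (statsOf w m) (length w) b x
  statsOf-∷ʳ w m b x {k} e ∣m∣≡∣w∣ =
    cong₆ stats (endHeight-∷ʳ 0 w b) (lastStep-∷ʳ w b) validity (countMarks-∷ʳ m x) (maj-∷ʳ w b)
          (trans (halfMarked-∷ʳ m x) (cong (λ n → halfMarked m + (if x then n / 2 else 0)) ∣m∣≡∣w∣))
    where
    cong₆ : ∀ {A B C D E F G : Set} (f : A → B → C → D → E → F → G) {a a′ b b′ c c′ d d′ e e′ g g′} →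
            a ≡ a′ → b ≡ b′ → c ≡ c′ → d ≡ d′ → e ≡ e′ → g ≡ g′ → f a b c d e g ≡ f a′ b′ c′ d′ e′ g′
    cong₆ f refl refl refl refl refl refl = refl
    validity : marksValid (w ∷ʳ b) (m ∷ʳ x)
               ≡ marksValid w m ∧ (if x then valley (lastStep w) b ∧ endsAt (endHeight 0 w) 0 else true)
    validity = begin
      marksValid (w ∷ʳ b) (m ∷ʳ x)
        ≡⟨ marksValid-∷ʳ (w ∷ʳ b) m x ⟩
      marksValid (w ∷ʳ b) m ∧ (if x then returnAt (w ∷ʳ b) (length m) else true)
        ≡⟨ cong₂ (λ v c → v ∧ (if x then c else true))
                 (marksValid-∷ʳ-path w b m (≤-reflexive ∣m∣≡∣w∣))
                 (trans (cong (returnAt (w ∷ʳ b)) ∣m∣≡∣w∣) (returnAt-∷ʳ-length w b)) ⟩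
      marksValid w m ∧ (if x then valley (lastStep w) b ∧ isZero (height w (length w)) else true)
        ≡⟨ cong (λ z → marksValid w m ∧ (if x then valley (lastStep w) b ∧ z else true)) (isZero-height-length w e) ⟩
      marksValid w m ∧ (if x then valley (lastStep w) b ∧ endsAt (endHeight 0 w) 0 else true) ∎

module Transfer where

  open import Data.Bool using (Bool; true; false; not; _∧_; if_then_else_)
  open import Data.Bool.Properties using (∧-zeroʳ)
  open import Data.Integer using (ℤ; +_; _+_; _*_; _^_)
  open import Data.Integer.Properties using (+-identityˡ; +-identityʳ; +-comm; *-identityˡ; *-zeroʳ; ^-distribˡ-+-*)
  open import Data.List using (_∷ʳ_; length)
  open import Data.Maybe using (just; nothing; _>>=_)
  open import Data.Nat as ℕ using (ℕ; zero; suc; _∸_; _≤_; _≤ᵇ_; _/_)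
  open import Data.Nat.DivMod using (m/n≤m)
  import Data.Nat.Properties as ℕ
  open ≡-Reasoning
  open Paths
  open Sums

  q^-∸-split : ∀ (q : ℤ) {M H} a b → H ≤ M → b ≤ a → q ^ ((M ℕ.+ a) ∸ (H ℕ.+ b)) ≡ q ^ (a ∸ b) * q ^ (M ∸ H)
  q^-∸-split q {M} {H} a b H≤M b≤a = trans (cong (q ^_) exponent) (^-distribˡ-+-* q (a ∸ b) (M ∸ H))
    where
    exponent : (M ℕ.+ a) ∸ (H ℕ.+ b) ≡ (a ∸ b) ℕ.+ (M ∸ H)
    exponent = begin
      (M ℕ.+ a) ∸ (H ℕ.+ b)             ≡⟨ cong (λ m → (m ℕ.+ a) ∸ (H ℕ.+ b)) (ℕ.m∸n+n≡m H≤M) ⟨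
      ((M ∸ H) ℕ.+ H ℕ.+ a) ∸ (H ℕ.+ b) ≡⟨ cong (_∸ (H ℕ.+ b)) (ℕ.+-assoc (M ∸ H) H a) ⟩
      ((M ∸ H) ℕ.+ (H ℕ.+ a)) ∸ (H ℕ.+ b) ≡⟨ cong (_∸ (H ℕ.+ b)) (ℕ.+-comm (M ∸ H) (H ℕ.+ a)) ⟩
      (H ℕ.+ a ℕ.+ (M ∸ H)) ∸ (H ℕ.+ b)   ≡⟨ cong (_∸ (H ℕ.+ b)) (ℕ.+-assoc H a (M ∸ H)) ⟩
      (H ℕ.+ (a ℕ.+ (M ∸ H))) ∸ (H ℕ.+ b) ≡⟨ ℕ.[m+n]∸[m+o]≡n∸o H _ b ⟩
      (a ℕ.+ (M ∸ H)) ∸ b                 ≡⟨ ℕ.+-∸-comm (M ∸ H) b≤a ⟩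
      (a ∸ b) ℕ.+ (M ∸ H) ∎

  ≤ᵇ-+1 : ∀ r K → (r ≤ᵇ K ℕ.+ 1) ≡ (r ∸ 1 ≤ᵇ K)
  ≤ᵇ-+1 zero    K = refl
  ≤ᵇ-+1 (suc r) K = trans (cong (r ℕ.<ᵇ_) (ℕ.+-comm K 1)) (<ᵇ-suc r)
    where
    <ᵇ-suc : ∀ r → (r ℕ.<ᵇ suc K) ≡ (r ≤ᵇ K)
    <ᵇ-suc zero    = refl
    <ᵇ-suc (suc r) = refl

  module _ (q : ℤ) where

    markWeight : ℕ → Stats → ℤ
    markWeight r S = ind (valid S ∧ (r ≤ᵇ marks S)) (q ^ (majIndex S ∸ half S))

    markWeight-unmarked : ∀ r S n b → Sound S →
      markWeight r (extend S n b false) ≡ (if valley (lastUp S) b then q ^ n * markWeight r S else markWeight r S)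
    markWeight-unmarked r (stats e L V K M H) n b sound = onFields (valley L b) V sound
      where
      onFields : ∀ c V → (V ≡ true → H ≤ M) →
        ind ((V ∧ true) ∧ (r ≤ᵇ K ℕ.+ 0)) (q ^ ((M ℕ.+ (if c then n else 0)) ∸ (H ℕ.+ 0)))
        ≡ (if c then q ^ n * ind (V ∧ (r ≤ᵇ K)) (q ^ (M ∸ H)) else ind (V ∧ (r ≤ᵇ K)) (q ^ (M ∸ H)))
      onFields true  false _ = sym (*-zeroʳ (q ^ n))
      onFields false false _ = refl
      onFields c true H≤M rewrite ℕ.+-identityʳ K with r ≤ᵇ K | c
      ... | false | true  = sym (*-zeroʳ (q ^ n))
      ... | false | false = refl
      ... | true  | true  = q^-∸-split q n 0 (H≤M refl) ℕ.z≤n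
      ... | true  | false = trans (q^-∸-split q 0 0 (H≤M refl) ℕ.z≤n) (*-identityˡ _)

    markWeight-marked : ∀ r S n b → Sound S →
      markWeight r (extend S n b true)
      ≡ ind (valley (lastUp S) b) (ind (endsAt (end S) 0) (q ^ (n ∸ n / 2) * markWeight (r ∸ 1) S))
    markWeight-marked r (stats e L V K M H) n b sound = onFields (valley L b) (endsAt e 0) V sound
      where
      onFields : ∀ c z V → (V ≡ true → H ≤ M) →
        ind ((V ∧ (c ∧ z)) ∧ (r ≤ᵇ K ℕ.+ 1)) (q ^ ((M ℕ.+ (if c then n else 0)) ∸ (H ℕ.+ n / 2)))
        ≡ ind c (ind z (q ^ (n ∸ n / 2) * ind (V ∧ (r ∸ 1 ≤ᵇ K)) (q ^ (M ∸ H))))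
      onFields false z     V _ rewrite ∧-zeroʳ V = refl
      onFields true  false V _ rewrite ∧-zeroʳ V = refl
      onFields true  true  false _ = sym (*-zeroʳ (q ^ (n ∸ n / 2)))
      onFields true  true  true  H≤M rewrite ≤ᵇ-+1 r K with r ∸ 1 ≤ᵇ K
      ... | false = sym (*-zeroʳ (q ^ (n ∸ n / 2)))
      ... | true  = q^-∸-split q n (n / 2) (H≤M refl) (m/n≤m n 2)

    lastUpWeight lastDownWeight : ℕ → Stats → ℤ
    lastUpWeight   r S = ind (lastUp S) (markWeight r S)
    lastDownWeight r S = ind (not (lastUp S)) (markWeight r S)

    atHeight : ℕ → (Stats → ℤ) → Stats → ℤ
    atHeight h G S = ind (endsAt (end S) h) (G S)

    endingUp endingDown : ℕ → ℕ → Stats → ℤ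
    endingUp   h r = atHeight h (lastUpWeight r)
    endingDown h r = atHeight h (lastDownWeight r)

    endingUp-extend-down : ∀ h r S n x → endingUp h r (extend S n false x) ≡ + 0
    endingUp-extend-down h r S n x = ind-0 (endsAt (end S >>= step false) h)

    endingDown-extend-up : ∀ h r S n x → endingDown h r (extend S n true x) ≡ + 0
    endingDown-extend-up h r S n x = ind-0 (endsAt (end S >>= step true) h)

    endingDown-extend-marked : ∀ h r S n → Sound S → endingDown h r (extend S n false true) ≡ + 0
    endingDown-extend-marked h r S n sound =
      trans (cong (ind (endsAt (end S >>= step false) h)) (markWeight-marked r S n false sound))
            (ind-0 (endsAt (end S >>= step false) h))

    endingDown-extend-unmarked : ∀ h r S n → Sound S →
      endingDown h r (extend S n false false) ≡ endingUp (suc h) r S + endingDown (suc h) r S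
    endingDown-extend-unmarked h r S n sound = begin
      ind (endsAt (end S >>= step false) h) (markWeight r (extend S n false false))
        ≡⟨ cong₂ ind (endsAt-step-down (end S) h) (markWeight-unmarked r S n false sound) ⟩
      ind (endsAt (end S) (suc h)) (markWeight r S)
        ≡⟨ split (endsAt (end S) (suc h)) (lastUp S) ⟩
      endingUp (suc h) r S + endingDown (suc h) r S ∎
      where
      split : ∀ E L → ind E (markWeight r S) ≡ ind E (ind L (markWeight r S)) + ind E (ind (not L) (markWeight r S))
      split false L     = refl
      split true  true  = sym (+-identityʳ _)
      split true  false = sym (+-identityˡ _)

    endingUp-extend-unmarked : ∀ h r S n → Sound S →
      endingUp (suc h) r (extend S n true false) ≡ endingUp h r S + q ^ n * endingDown h r S
    endingUp-extend-unmarked h r S n sound = begin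
      ind (endsAt (end S >>= step true) (suc h)) (markWeight r (extend S n true false))
        ≡⟨ cong₂ ind (endsAt-step-up (end S) h) (markWeight-unmarked r S n true sound) ⟩
      ind (endsAt (end S) h) (if not (lastUp S) then q ^ n * markWeight r S else markWeight r S)
        ≡⟨ split (endsAt (end S) h) (lastUp S) (markWeight r S) ⟩
      endingUp h r S + q ^ n * endingDown h r S ∎
      where
      split : ∀ E L w → ind E (if not L then q ^ n * w else w) ≡ ind E (ind L w) + q ^ n * ind E (ind (not L) w)
      split false L     w = sym (trans (+-identityˡ _) (*-zeroʳ (q ^ n)))
      split true  true  w = sym (trans (cong (_+_ w) (*-zeroʳ (q ^ n))) (+-identityʳ w))
      split true  false w = sym (+-identityˡ _)

    -- Only a return can be marked, so the up-step after a marked vertex ends at height 1.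
    endingUp-extend-marked : ∀ h r S n → Sound S →
      endingUp (suc h) r (extend S n true true) ≡ ind (h ℕ.≡ᵇ 0) (q ^ (n ∸ n / 2) * endingDown 0 (r ∸ 1) S)
    endingUp-extend-marked h r S n sound =
      trans (cong₂ ind (endsAt-step-up (end S) h) (markWeight-marked r S n true sound))
            (split h (end S) (lastUp S))
      where
      c = q ^ (n ∸ n / 2)
      w = markWeight (r ∸ 1) S
      vanishes : ∀ h → + 0 ≡ ind (h ℕ.≡ᵇ 0) (c * + 0)
      vanishes h = sym (trans (cong (ind (h ℕ.≡ᵇ 0)) (*-zeroʳ c)) (ind-0 (h ℕ.≡ᵇ 0)))
      split : ∀ h e L → ind (endsAt e h) (ind (not L) (ind (endsAt e 0) (c * w)))
                        ≡ ind (h ℕ.≡ᵇ 0) (c * ind (endsAt e 0) (ind (not L) w))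
      split h       nothing        L     = vanishes h
      split h       (just (suc k)) L     = trans (cong (ind (suc k ℕ.≡ᵇ h)) (ind-0 (not L))) (trans (ind-0 _) (vanishes h))
      split (suc h) (just zero)    L     = refl
      split zero    (just zero)    true  = sym (*-zeroʳ c)
      split zero    (just zero)    false = refl

    endingUp-extend-zero : ∀ r S n x → endingUp 0 r (extend S n true x) ≡ + 0
    endingUp-extend-zero r S n x = vanishes (end S)
      where
      vanishes : ∀ e → ind (endsAt (e >>= step true) 0) (markWeight r (extend S n true x)) ≡ + 0
      vanishes nothing  = refl
      vanishes (just k) = refl

    extend-down : ∀ h r S n → Sound S →
      sumBool² (λ b x → endingDown h r (extend S n b x)) ≡ endingUp (suc h) r S + endingDown (suc h) r S
    extend-down h r S n sound =
      trans (cong₂ _+_ (cong₂ _+_ (endingDown-extend-up h r S n true) (endingDown-extend-up h r S n false))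
                       (cong₂ _+_ (endingDown-extend-marked h r S n sound) (endingDown-extend-unmarked h r S n sound)))
            (trans (+-identityˡ _) (+-identityˡ _))

    extend-up-high : ∀ h r S n → Sound S →
      sumBool² (λ b x → endingUp (suc (suc h)) r (extend S n b x)) ≡ endingUp (suc h) r S + q ^ n * endingDown (suc h) r S
    extend-up-high h r S n sound =
      trans (cong₂ _+_ (cong₂ _+_ (endingUp-extend-marked (suc h) r S n sound) (endingUp-extend-unmarked (suc h) r S n sound))
                       (cong₂ _+_ (endingUp-extend-down _ r S n true) (endingUp-extend-down _ r S n false)))
            (trans (+-identityʳ _) (+-identityˡ _))

    extend-up-one : ∀ r S n → Sound S →
      sumBool² (λ b x → endingUp 1 r (extend S n b x))
      ≡ endingUp 0 r S + q ^ n * endingDown 0 r S + q ^ (n ∸ n / 2) * endingDown 0 (r ∸ 1) S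
    extend-up-one r S n sound =
      trans (cong₂ _+_ (cong₂ _+_ (endingUp-extend-marked 0 r S n sound) (endingUp-extend-unmarked 0 r S n sound))
                       (cong₂ _+_ (endingUp-extend-down 1 r S n true) (endingUp-extend-down 1 r S n false)))
            (trans (+-identityʳ _) (+-comm (q ^ (n ∸ n / 2) * endingDown 0 (r ∸ 1) S) _))

    extend-up-zero : ∀ r S n → sumBool² (λ b x → endingUp 0 r (extend S n b x)) ≡ + 0
    extend-up-zero r S n =
      cong₂ _+_ (cong₂ _+_ (endingUp-extend-zero r S n true) (endingUp-extend-zero r S n false))
                (cong₂ _+_ (endingUp-extend-down 0 r S n true) (endingUp-extend-down 0 r S n false))

    up down : ℕ → ℕ → ℕ → ℤ
    up   n h r = sumAll² n (λ w m → endingUp   h r (statsOf w m))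
    down n h r = sumAll² n (λ w m → endingDown h r (statsOf w m))

    atHeight-∷ʳ : ∀ h (G : Stats → ℤ) {n} w m b x → length w ≡ n → length m ≡ n →
      atHeight h G (statsOf (w ∷ʳ b) (m ∷ʳ x)) ≡ atHeight h G (extend (statsOf w m) n b x)
    atHeight-∷ʳ h G {n} w m b x ∣w∣ ∣m∣ = byEndHeight (endHeight 0 w) refl
      where
      byEndHeight : ∀ e → endHeight 0 w ≡ e →
        atHeight h G (statsOf (w ∷ʳ b) (m ∷ʳ x)) ≡ atHeight h G (extend (statsOf w m) n b x)
      byEndHeight (just k) eq = cong (atHeight h G)
        (trans (statsOf-∷ʳ w m b x eq (trans ∣m∣ (sym ∣w∣))) (cong (λ n → extend (statsOf w m) n b x) ∣w∣))
      byEndHeight nothing  eq =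
        trans (cong (λ e → ind (endsAt e h) (G (statsOf (w ∷ʳ b) (m ∷ʳ x))))
                    (trans (endHeight-∷ʳ 0 w b) (cong (_>>= step b) eq)))
              (cong (λ e → ind (endsAt (e >>= step b) h) (G (extend (statsOf w m) n b x))) (sym eq))

    sumAll²-extend : ∀ n h (G R : Stats → ℤ) →
      (∀ S → Sound S → sumBool² (λ b x → atHeight h G (extend S n b x)) ≡ R S) →
      sumAll² (suc n) (λ w m → atHeight h G (statsOf w m)) ≡ sumAll² n (λ w m → R (statsOf w m))
    sumAll²-extend n h G R extendS = trans (sumAll²-∷ʳ n _) (sumAll²-cong n λ w m ∣w∣ ∣m∣ →
      trans (sumBool²-cong λ b x → atHeight-∷ʳ h G w m b x ∣w∣ ∣m∣)
            (extendS (statsOf w m) (halfMarked≤maj w m (trans ∣m∣ (sym ∣w∣)))))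

    down-suc : ∀ n h r → down (suc n) h r ≡ up n (suc h) r + down n (suc h) r
    down-suc n h r =
      trans (sumAll²-extend n h (lastDownWeight r) (λ S → endingUp (suc h) r S + endingDown (suc h) r S)
                            (λ S sound → extend-down h r S n sound))
            (sumAll²-+ n _ _)

    up-suc-high : ∀ n h r → up (suc n) (suc (suc h)) r ≡ up n (suc h) r + q ^ n * down n (suc h) r
    up-suc-high n h r =
      trans (sumAll²-extend n (suc (suc h)) (lastUpWeight r) (λ S → endingUp (suc h) r S + q ^ n * endingDown (suc h) r S)
                            (λ S sound → extend-up-high h r S n sound))
            (trans (sumAll²-+ n _ _)
                   (cong (_+_ (up n (suc h) r)) (sumAll²-* n (q ^ n) (λ w m → endingDown (suc h) r (statsOf w m)))))

    up-suc-one : ∀ n r → up (suc n) 1 r ≡ up n 0 r + q ^ n * down n 0 r + q ^ (n ∸ n / 2) * down n 0 (r ∸ 1)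
    up-suc-one n r =
      trans (sumAll²-extend n 1 (lastUpWeight r)
                            (λ S → endingUp 0 r S + q ^ n * endingDown 0 r S + q ^ (n ∸ n / 2) * endingDown 0 (r ∸ 1) S)
                            (λ S sound → extend-up-one r S n sound))
            (trans (sumAll²-+ n _ _)
                   (cong₂ _+_ (trans (sumAll²-+ n _ _) (cong (_+_ (up n 0 r)) (sumAll²-* n (q ^ n) (λ w m → endingDown 0 r (statsOf w m)))))
                              (sumAll²-* n (q ^ (n ∸ n / 2)) (λ w m → endingDown 0 (r ∸ 1) (statsOf w m)))))

    up-suc-zero : ∀ n r → up (suc n) 0 r ≡ + 0
    up-suc-zero n r =
      trans (sumAll²-extend n 0 (lastUpWeight r) (λ _ → + 0) (λ S _ → extend-up-zero r S n)) (sumAll²-0 n)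

module ClosedForms where

  open import Data.Empty using (⊥-elim)
  open import Data.Integer using (ℤ; +_; _+_; _*_; _^_)
  open import Data.Integer.Properties using (+-identityʳ; *-assoc; ^-distribˡ-+-*)
  open import Data.Integer.Tactic.RingSolver using (solve-∀)
  open import Data.Nat as ℕ using (ℕ; zero; suc; _∸_; _≤_; _<_; s≤s; compare; less; equal; greater)
  open import Data.Nat.Combinatorics using (_C_; nC1≡n; nCk+nC[k+1]≡[n+1]C[k+1])
  import Data.Nat.Properties as ℕ
  import Data.Nat.Tactic.RingSolver as ℕ-Solver
  open import Data.Product using (_,_)
  open import Relation.Nullary using (¬_)
  open ≡-Reasoning
  open QBinomial

  triangle : ℕ → ℕ
  triangle zero    = 0
  triangle (suc r) = triangle r ℕ.+ suc r

  ∸-less : ∀ d k → d ∸ (d ℕ.+ k) ≡ 0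
  ∸-less d k = ℕ.m≤n⇒m∸n≡0 (ℕ.m≤m+n d k)

  ∸-less′ : ∀ d k → d ∸ suc (d ℕ.+ k) ≡ 0
  ∸-less′ d k = ℕ.m≤n⇒m∸n≡0 (ℕ.m≤n⇒m≤1+n (ℕ.m≤m+n d k))

  ∸-equal : ∀ d → suc d ∸ d ≡ 1
  ∸-equal d = ℕ.m+n∸n≡m 1 d

  ∸-greater : ∀ r a → suc (r ℕ.+ a) ∸ r ≡ suc a
  ∸-greater r a = trans (ℕ.+-∸-assoc 1 (ℕ.m≤m+n r a)) (cong suc (ℕ.m+n∸m≡n r a))

  ∸-greater′ : ∀ r a → suc (suc (r ℕ.+ a)) ∸ r ≡ suc (suc a)
  ∸-greater′ r a = trans (cong (λ x → suc x ∸ r) (sym (ℕ.+-suc r a))) (∸-greater r (suc a))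

  upClosed₀ : ℕ → ℕ → ℤ
  upClosed₀ _       (suc _) = + 0
  upClosed₀ zero    zero    = + 1
  upClosed₀ (suc _) zero    = + 0

  module _ (q : ℤ) where

    -- The values of down (2d + h) h r and up (2d + h + 1) (h + 1) r: d counts the down-steps.
    downClosed : ℕ → ℕ → ℕ → ℤ
    downClosed d h r = byExcess (d ∸ r)
      where
      byExcess : ℕ → ℤ
      byExcess zero    = + 0
      byExcess (suc a) = q ^ triangle r * qBinom q a (d ℕ.+ h ℕ.+ r)

    upClosed : ℕ → ℕ → ℕ → ℤ
    upClosed d h r = byExcess (suc d ∸ r)
      where
      byExcess : ℕ → ℤ
      byExcess zero    = + 0
      byExcess (suc a) = q ^ (triangle r ℕ.+ a) * qBinom q a (d ℕ.+ h ℕ.+ r)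

    downClosed-0 : ∀ d h r → d ∸ r ≡ 0 → downClosed d h r ≡ + 0
    downClosed-0 d h r e rewrite e = refl

    downClosed-suc : ∀ d h r {a} → d ∸ r ≡ suc a → downClosed d h r ≡ q ^ triangle r * qBinom q a (d ℕ.+ h ℕ.+ r)
    downClosed-suc d h r e rewrite e = refl

    upClosed-0 : ∀ d h r → suc d ∸ r ≡ 0 → upClosed d h r ≡ + 0
    upClosed-0 d h r e rewrite e = refl

    upClosed-suc : ∀ d h r {a} → suc d ∸ r ≡ suc a → upClosed d h r ≡ q ^ (triangle r ℕ.+ a) * qBinom q a (d ℕ.+ h ℕ.+ r)
    upClosed-suc d h r e rewrite e = refl

    q^-+ : ∀ x y X → q ^ x * (q ^ y * X) ≡ q ^ (x ℕ.+ y) * X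
    q^-+ x y X = trans (sym (*-assoc (q ^ x) (q ^ y) X)) (cong (_* X) (sym (^-distribˡ-+-* q x y)))

    downClosed-step : ∀ d h r → downClosed (suc d) h r ≡ upClosed d h r + downClosed d (suc h) r
    downClosed-step d h r with compare d r
    ... | less .d k =
      trans (downClosed-0 (suc d) h r (∸-less d k))
            (sym (cong₂ _+_ (upClosed-0 d h r (∸-less d k)) (downClosed-0 d (suc h) r (∸-less′ d k))))
    ... | equal .d = begin
      downClosed (suc d) h d                 ≡⟨ downClosed-suc (suc d) h d (∸-equal d) ⟩
      q ^ triangle d * + 1                   ≡⟨ cong (λ t → q ^ t * + 1) (ℕ.+-identityʳ (triangle d)) ⟨
      q ^ (triangle d ℕ.+ 0) * + 1           ≡⟨ +-identityʳ _ ⟨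
      q ^ (triangle d ℕ.+ 0) * + 1 + + 0     ≡⟨ cong₂ _+_ (upClosed-suc d h d (∸-equal d)) (downClosed-0 d (suc h) d (ℕ.n∸n≡0 d)) ⟨
      upClosed d h d + downClosed d (suc h) d ∎
    ... | greater .r a = begin
      downClosed (suc d′) h r
        ≡⟨ downClosed-suc (suc d′) h r (∸-greater′ r a) ⟩
      q ^ triangle r * qBinom q (suc a) (suc B)
        ≡⟨ ring (q ^ triangle r) (q ^ suc a) (qBinom q a (suc B)) (qBinom q (suc a) B) ⟩
      q ^ triangle r * (q ^ suc a * qBinom q (suc a) B) + q ^ triangle r * qBinom q a (suc B)
        ≡⟨ cong₂ _+_ (q^-+ (triangle r) (suc a) _)
                     (cong (λ n → q ^ triangle r * qBinom q a n) (sym (cong (ℕ._+ r) (ℕ.+-suc d′ h)))) ⟩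
      q ^ (triangle r ℕ.+ suc a) * qBinom q (suc a) B + q ^ triangle r * qBinom q a (d′ ℕ.+ suc h ℕ.+ r)
        ≡⟨ cong₂ _+_ (upClosed-suc d′ h r (∸-greater′ r a)) (downClosed-suc d′ (suc h) r (∸-greater r a)) ⟨
      upClosed d′ h r + downClosed d′ (suc h) r ∎
      where
      d′ = suc (r ℕ.+ a)
      B  = d′ ℕ.+ h ℕ.+ r
      ring : ∀ t s x y → t * (x + s * y) ≡ t * (s * y) + t * x
      ring = solve-∀

    upClosed-step : ∀ d h r → upClosed d (suc h) r ≡ upClosed d h r + q ^ (d ℕ.+ d ℕ.+ suc h) * downClosed d (suc h) r
    upClosed-step d h r with compare d r
    ... | less .d k = begin
      upClosed d (suc h) r          ≡⟨ upClosed-0 d (suc h) r (∸-less d k) ⟩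
      + 0                           ≡⟨ zero-combination (q ^ N) ⟩
      + 0 + q ^ N * + 0
        ≡⟨ cong₂ (λ u v → u + q ^ N * v) (upClosed-0 d h r (∸-less d k)) (downClosed-0 d (suc h) r (∸-less′ d k)) ⟨
      upClosed d h r + q ^ N * downClosed d (suc h) r ∎
      where
      N = d ℕ.+ d ℕ.+ suc h
      zero-combination : ∀ x → + 0 ≡ + 0 + x * + 0
      zero-combination = solve-∀
    ... | equal .d = begin
      upClosed d (suc h) d                   ≡⟨ upClosed-suc d (suc h) d (∸-equal d) ⟩
      q ^ (triangle d ℕ.+ 0) * + 1           ≡⟨ upClosed-suc d h d (∸-equal d) ⟨
      upClosed d h d                         ≡⟨ ring (upClosed d h d) (q ^ N) ⟩
      upClosed d h d + q ^ N * + 0           ≡⟨ cong (λ v → upClosed d h d + q ^ N * v) (downClosed-0 d (suc h) d (ℕ.n∸n≡0 d)) ⟨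
      upClosed d h d + q ^ N * downClosed d (suc h) d ∎
      where
      N = d ℕ.+ d ℕ.+ suc h
      ring : ∀ x y → x ≡ x + y * + 0
      ring = solve-∀
    ... | greater .r a = begin
      upClosed d′ (suc h) r
        ≡⟨ upClosed-suc d′ (suc h) r (∸-greater′ r a) ⟩
      q ^ E * qBinom q (suc a) (d′ ℕ.+ suc h ℕ.+ r)
        ≡⟨ cong (λ n → q ^ E * qBinom q (suc a) n) length-suc ⟩
      q ^ E * qBinom q (suc a) (suc B)
        ≡⟨ cong (q ^ E *_) (qBinom-pascal′ q a B) ⟩
      q ^ E * (q ^ suc B * qBinom q a (suc B) + qBinom q (suc a) B)
        ≡⟨ ring (q ^ E) (q ^ suc B * qBinom q a (suc B)) (qBinom q (suc a) B) ⟩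
      q ^ E * qBinom q (suc a) B + q ^ E * (q ^ suc B * qBinom q a (suc B))
        ≡⟨ cong (_+_ (q ^ E * qBinom q (suc a) B))
                (trans (q^-+ E (suc B) _) (sym (trans (q^-+ N (triangle r) _) (cong (λ n → q ^ n * qBinom q a (suc B)) exponent)))) ⟩
      q ^ E * qBinom q (suc a) B + q ^ N * (q ^ triangle r * qBinom q a (suc B))
        ≡⟨ cong₂ (λ u v → u + q ^ N * v) (upClosed-suc d′ h r (∸-greater′ r a))
                 (trans (downClosed-suc d′ (suc h) r (∸-greater r a)) (cong (λ n → q ^ triangle r * qBinom q a n) length-suc)) ⟨
      upClosed d′ h r + q ^ N * downClosed d′ (suc h) r ∎
      where
      d′ = suc (r ℕ.+ a)
      B  = d′ ℕ.+ h ℕ.+ r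
      E  = triangle r ℕ.+ suc a
      N  = d′ ℕ.+ d′ ℕ.+ suc h
      length-suc : d′ ℕ.+ suc h ℕ.+ r ≡ suc B
      length-suc = cong (ℕ._+ r) (ℕ.+-suc d′ h)
      exponent : N ℕ.+ triangle r ≡ E ℕ.+ suc B
      exponent = ℕ-ring (triangle r) r a h
        where
        ℕ-ring : ∀ t r a h → suc (r ℕ.+ a) ℕ.+ suc (r ℕ.+ a) ℕ.+ suc h ℕ.+ t
                             ≡ t ℕ.+ suc a ℕ.+ suc (suc (r ℕ.+ a) ℕ.+ h ℕ.+ r)
        ℕ-ring = ℕ-Solver.solve-∀
      ring : ∀ t x y → t * (x + y) ≡ t * y + t * x
      ring = solve-∀

    upClosed-axis : ∀ d r →
      upClosed d 0 r ≡ upClosed₀ d r + q ^ (d ℕ.+ d) * downClosed d 0 r + q ^ d * downClosed d 0 (r ∸ 1)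
    upClosed-axis zero    zero = refl
    upClosed-axis (suc a) zero = begin
      q ^ suc a * qBinom q (suc a) B             ≡⟨ cong (λ n → q ^ suc a * qBinom q (suc a) n) length-eq ⟩
      q ^ suc a * qBinom q (suc a) (suc a)
        ≡⟨ cong (q ^ suc a *_) (trans (qBinom-pascal′ q a a) (cong (_+_ (q ^ suc a * qBinom q a (suc a))) (qBinom-sym q (suc a) a))) ⟩
      q ^ suc a * (q ^ suc a * qBinom q a (suc a) + qBinom q a (suc a))
        ≡⟨ ring (q ^ suc a) (qBinom q a (suc a)) ⟩
      + 0 + q ^ suc a * q ^ suc a * (+ 1 * qBinom q a (suc a)) + q ^ suc a * (+ 1 * qBinom q a (suc a))
        ≡⟨ cong₂ (λ u n → + 0 + u * (+ 1 * qBinom q a n) + q ^ suc a * (+ 1 * qBinom q a n))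
                 (sym (^-distribˡ-+-* q (suc a) (suc a))) (sym length-eq) ⟩
      + 0 + q ^ (suc a ℕ.+ suc a) * (+ 1 * qBinom q a B) + q ^ suc a * (+ 1 * qBinom q a B) ∎
      where
      B = suc a ℕ.+ 0 ℕ.+ 0
      length-eq : B ≡ suc a
      length-eq = trans (ℕ.+-identityʳ (suc a ℕ.+ 0)) (ℕ.+-identityʳ (suc a))
      ring : ∀ s x → s * (s * x + x) ≡ + 0 + s * s * (+ 1 * x) + s * (+ 1 * x)
      ring = solve-∀
    upClosed-axis d (suc r) with compare d (suc r)
    ... | less .d k = begin
      upClosed d 0 (suc (d ℕ.+ k))       ≡⟨ upClosed-0 d 0 (suc (d ℕ.+ k)) (∸-less d k) ⟩
      + 0                                ≡⟨ ring (q ^ (d ℕ.+ d)) (q ^ d) ⟩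
      + 0 + q ^ (d ℕ.+ d) * + 0 + q ^ d * + 0
        ≡⟨ cong₂ (λ u v → + 0 + q ^ (d ℕ.+ d) * u + q ^ d * v)
                 (downClosed-0 d 0 (suc (d ℕ.+ k)) (∸-less′ d k)) (downClosed-0 d 0 (d ℕ.+ k) (∸-less d k)) ⟨
      + 0 + q ^ (d ℕ.+ d) * downClosed d 0 (suc (d ℕ.+ k)) + q ^ d * downClosed d 0 (d ℕ.+ k) ∎
      where
      ring : ∀ x y → + 0 ≡ + 0 + x * + 0 + y * + 0
      ring = solve-∀
    ... | equal .(suc r) = begin
      upClosed (suc r) 0 (suc r)          ≡⟨ upClosed-suc (suc r) 0 (suc r) (∸-equal (suc r)) ⟩
      q ^ (triangle (suc r) ℕ.+ 0) * + 1   ≡⟨ cong (λ n → q ^ n * + 1) exponent ⟨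
      q ^ (suc r ℕ.+ triangle r) * + 1     ≡⟨ q^-+ (suc r) (triangle r) (+ 1) ⟨
      q ^ suc r * (q ^ triangle r * + 1)   ≡⟨ ring (q ^ (suc r ℕ.+ suc r)) (q ^ suc r * (q ^ triangle r * + 1)) ⟩
      + 0 + q ^ (suc r ℕ.+ suc r) * + 0 + q ^ suc r * (q ^ triangle r * + 1)
        ≡⟨ cong₂ (λ u v → + 0 + q ^ (suc r ℕ.+ suc r) * u + q ^ suc r * v)
                 (downClosed-0 (suc r) 0 (suc r) (ℕ.n∸n≡0 (suc r))) (downClosed-suc (suc r) 0 r (∸-equal r)) ⟨
      + 0 + q ^ (suc r ℕ.+ suc r) * downClosed (suc r) 0 (suc r) + q ^ suc r * downClosed (suc r) 0 r ∎
      where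
      exponent : suc r ℕ.+ triangle r ≡ triangle (suc r) ℕ.+ 0
      exponent = ℕ-ring (triangle r) r
        where
        ℕ-ring : ∀ t r → suc r ℕ.+ t ≡ t ℕ.+ suc r ℕ.+ 0
        ℕ-ring = ℕ-Solver.solve-∀
      ring : ∀ x y → y ≡ + 0 + x * + 0 + y
      ring = solve-∀
    ... | greater .(suc r) a = begin
      upClosed d′ 0 (suc r)
        ≡⟨ upClosed-suc d′ 0 (suc r) (∸-greater′ (suc r) a) ⟩
      q ^ E * qBinom q (suc a) (d′ ℕ.+ 0 ℕ.+ suc r)
        ≡⟨ cong (λ n → q ^ E * qBinom q (suc a) n) length-suc ⟩
      q ^ E * qBinom q (suc a) (suc B)
        ≡⟨ cong (q ^ E *_) (qBinom-pascal′ q a B) ⟩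
      q ^ E * (q ^ suc B * qBinom q a (suc B) + qBinom q (suc a) B)
        ≡⟨ ring (q ^ E) (q ^ suc B * qBinom q a (suc B)) (qBinom q (suc a) B) ⟩
      + 0 + q ^ E * (q ^ suc B * qBinom q a (suc B)) + q ^ E * qBinom q (suc a) B
        ≡⟨ cong₂ (λ u v → + 0 + u + v)
                 (trans (q^-+ E (suc B) _) (sym (trans (q^-+ N T _) (cong (λ n → q ^ n * qBinom q a (suc B)) exponent₁))))
                 (sym (trans (q^-+ d′ (triangle r) _) (cong (λ n → q ^ n * qBinom q (suc a) B) exponent₂))) ⟩
      + 0 + q ^ N * (q ^ T * qBinom q a (suc B)) + q ^ d′ * (q ^ triangle r * qBinom q (suc a) B)
        ≡⟨ cong₂ (λ u v → + 0 + q ^ N * u + q ^ d′ * v)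
                 (trans (downClosed-suc d′ 0 (suc r) (∸-greater (suc r) a)) (cong (λ n → q ^ T * qBinom q a n) length-suc))
                 (downClosed-suc d′ 0 r (∸-greater′ r a)) ⟨
      + 0 + q ^ N * downClosed d′ 0 (suc r) + q ^ d′ * downClosed d′ 0 r ∎
      where
      d′ = suc (suc r ℕ.+ a)
      T  = triangle (suc r)
      E  = T ℕ.+ suc a
      N  = d′ ℕ.+ d′
      B  = d′ ℕ.+ 0 ℕ.+ r
      length-suc : d′ ℕ.+ 0 ℕ.+ suc r ≡ suc B
      length-suc = ℕ.+-suc (d′ ℕ.+ 0) r
      exponent₁ : N ℕ.+ T ≡ E ℕ.+ suc B
      exponent₁ = ℕ-ring (triangle r) r a
        where
        ℕ-ring : ∀ t r a → suc (suc r ℕ.+ a) ℕ.+ suc (suc r ℕ.+ a) ℕ.+ (t ℕ.+ suc r)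
                           ≡ t ℕ.+ suc r ℕ.+ suc a ℕ.+ suc (suc (suc r ℕ.+ a) ℕ.+ 0 ℕ.+ r)
        ℕ-ring = ℕ-Solver.solve-∀
      exponent₂ : d′ ℕ.+ triangle r ≡ E
      exponent₂ = ℕ-ring (triangle r) r a
        where
        ℕ-ring : ∀ t r a → suc (suc r ℕ.+ a) ℕ.+ t ≡ t ℕ.+ suc r ℕ.+ suc a
        ℕ-ring = ℕ-Solver.solve-∀
      ring : ∀ t x y → t * (x + y) ≡ + 0 + t * x + t * y
      ring = solve-∀

  triangle≡C : ∀ r → triangle r ≡ (r ℕ.+ 1) C 2
  triangle≡C r = trans (triangle≡sucC r) (cong (_C 2) (ℕ.+-comm 1 r))
    where
    triangle≡sucC : ∀ r → triangle r ≡ suc r C 2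
    triangle≡sucC zero    = refl
    triangle≡sucC (suc r) = begin
      triangle r ℕ.+ suc r           ≡⟨ cong (ℕ._+ suc r) (triangle≡sucC r) ⟩
      suc r C 2 ℕ.+ suc r            ≡⟨ ℕ.+-comm (suc r C 2) (suc r) ⟩
      suc r ℕ.+ suc r C 2            ≡⟨ cong (ℕ._+ suc r C 2) (nC1≡n (suc r)) ⟨
      suc r C 1 ℕ.+ suc r C 2        ≡⟨ nCk+nC[k+1]≡[n+1]C[k+1] (suc r) 1 ⟩
      suc (suc r) C 2 ∎

  EqScaledQBinom-cong : ∀ {f g c c′ : ℤ → ℤ} {n k} → (∀ q → f q ≡ g q) → (∀ q → c q ≡ c′ q) →
                        EqScaledQBinom g c′ n k → EqScaledQBinom f c n k
  EqScaledQBinom-cong {n = n} {k} f≗g c≗c′ (inRange , outOfRange) =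
    (λ k≤n q → trans (cong (λ x → x * qPoch q k * qPoch q (n ∸ k)) (f≗g q))
                     (trans (inRange k≤n q) (cong (_* qPoch q n) (sym (c≗c′ q))))) ,
    (λ k≰n q → trans (f≗g q) (outOfRange k≰n q))

  belowDiagonal-eqScaled : ∀ s r → 1 ≤ s → s ≤ r →
    EqScaledQBinom (λ q → downClosed q s 0 r) (λ q → q ^ triangle r) (2 ℕ.* s ∸ 1) (s ℕ.+ r)
  belowDiagonal-eqScaled s r 1≤s s≤r =
    (λ s+r≤2s-1 → ⊥-elim (ℕ.n≮n (s ℕ.+ r) (ℕ.<-≤-trans (ℕ.≤-<-trans s+r≤2s-1 (2s-1<s+s 1≤s)) (ℕ.+-monoʳ-≤ s s≤r)))) ,
    (λ _ q → downClosed-0 q s 0 r (ℕ.m≤n⇒m∸n≡0 s≤r))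
    where
    2s-1<s+s : ∀ {s} → 1 ≤ s → 2 ℕ.* s ∸ 1 < s ℕ.+ s
    2s-1<s+s {suc s} _ = s≤s (ℕ.≤-reflexive (cong (s ℕ.+_) (ℕ.+-identityʳ (suc s))))

  aboveDiagonal-eqScaled : ∀ r a → let s = suc (r ℕ.+ a) in
    EqScaledQBinom (λ q → downClosed q s 0 r) (λ q → q ^ triangle r) (2 ℕ.* s ∸ 1) (s ℕ.+ r)
  aboveDiagonal-eqScaled r a = inRange , outOfRange
    where
    s = suc (r ℕ.+ a)
    B = s ℕ.+ 0 ℕ.+ r
    length≡ : 2 ℕ.* s ∸ 1 ≡ s ℕ.+ r ℕ.+ a
    length≡ = ℕ-ring r a
      where
      ℕ-ring : ∀ r a → r ℕ.+ a ℕ.+ suc (r ℕ.+ a ℕ.+ 0) ≡ suc (r ℕ.+ a) ℕ.+ r ℕ.+ a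
      ℕ-ring = ℕ-Solver.solve-∀
    inRange : s ℕ.+ r ≤ 2 ℕ.* s ∸ 1 → ∀ q →
              downClosed q s 0 r * qPoch q (s ℕ.+ r) * qPoch q (2 ℕ.* s ∸ 1 ∸ (s ℕ.+ r)) ≡ q ^ triangle r * qPoch q (2 ℕ.* s ∸ 1)
    inRange _ q = begin
      downClosed q s 0 r * P (s ℕ.+ r) * P (2 ℕ.* s ∸ 1 ∸ (s ℕ.+ r))
        ≡⟨ cong₂ (λ x n → x * P (s ℕ.+ r) * P n) (downClosed-suc q s 0 r (∸-greater r a))
                 (trans (cong (_∸ (s ℕ.+ r)) length≡) (ℕ.m+n∸m≡n (s ℕ.+ r) a)) ⟩
      q ^ triangle r * qBinom q a B * P (s ℕ.+ r) * P a
        ≡⟨ cong (λ n → q ^ triangle r * qBinom q a B * P n * P a) (cong (ℕ._+ r) (sym (ℕ.+-identityʳ s))) ⟩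
      q ^ triangle r * qBinom q a B * P B * P a
        ≡⟨ ring (q ^ triangle r) (qBinom q a B) (P B) (P a) ⟩
      q ^ triangle r * (qBinom q a B * P a * P B)
        ≡⟨ cong (q ^ triangle r *_) (qBinom-qPoch q a B) ⟩
      q ^ triangle r * P (a ℕ.+ B)
        ≡⟨ cong (λ n → q ^ triangle r * P n) total ⟩
      q ^ triangle r * P (2 ℕ.* s ∸ 1) ∎
      where
      P = qPoch q
      ring : ∀ t x pᴮ pᵃ → t * x * pᴮ * pᵃ ≡ t * (x * pᵃ * pᴮ)
      ring = solve-∀
      total : a ℕ.+ B ≡ 2 ℕ.* s ∸ 1
      total = ℕ-ring r a
        where
        ℕ-ring : ∀ r a → a ℕ.+ (suc (r ℕ.+ a) ℕ.+ 0 ℕ.+ r) ≡ r ℕ.+ a ℕ.+ suc (r ℕ.+ a ℕ.+ 0)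
        ℕ-ring = ℕ-Solver.solve-∀
    outOfRange : ¬ (s ℕ.+ r ≤ 2 ℕ.* s ∸ 1) → ∀ q → downClosed q s 0 r ≡ + 0
    outOfRange s+r≰2s-1 = ⊥-elim (s+r≰2s-1 (ℕ.≤-trans (ℕ.m≤m+n (s ℕ.+ r) a) (ℕ.≤-reflexive (sym length≡))))

  downClosed-eqScaled : ∀ s → 1 ≤ s → ∀ r →
    EqScaledQBinom (λ q → downClosed q s 0 r) (λ q → q ^ triangle r) (2 ℕ.* s ∸ 1) (s ℕ.+ r)
  downClosed-eqScaled s 1≤s r with compare s r
  ... | less .s k    = belowDiagonal-eqScaled s _ 1≤s (ℕ.m≤n⇒m≤1+n (ℕ.m≤m+n s k))
  ... | equal .s     = belowDiagonal-eqScaled s s 1≤s ℕ.≤-refl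
  ... | greater .r a = aboveDiagonal-eqScaled r a

module Enumeration where

  open import Data.Bool using (Bool; true; false; not; _∧_)
  open import Data.Bool.Properties using (∧-identityʳ; ∧-zeroʳ)
  open import Data.Integer using (ℤ; +_; _+_; _*_; _^_)
  open import Data.Integer.Properties using (+-identityˡ; *-zeroʳ)
  open import Data.List using (List; _∷_; _∷ʳ_; map; concatMap; length)
  open import Data.List.Properties using (map-∘)
  open import Data.Nat as ℕ using (ℕ; zero; suc; _∸_; _≤_; _<_; _/_; _≤ᵇ_; s≤s)
  open import Data.Nat.DivMod using (m*n/n≡m)
  import Data.Nat.Properties as ℕ
  import Data.Nat.Tactic.RingSolver as ℕ-Solver
  open import Data.Product using (_,_; proj₁; proj₂)
  open import Function using (_∘_)
  open ≡-Reasoning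
  open Sums
  open Paths
  open Transfer
  open ClosedForms

  pathLength : ℕ → ℕ → ℕ
  pathLength zero    h = h
  pathLength (suc d) h = suc (suc (pathLength d h))

  pathLength-suc : ∀ d h → pathLength d (suc h) ≡ suc (pathLength d h)
  pathLength-suc zero    h = refl
  pathLength-suc (suc d) h = cong (suc ∘ suc) (pathLength-suc d h)

  pathLength≡ : ∀ d h → pathLength d h ≡ d ℕ.+ d ℕ.+ h
  pathLength≡ zero    h = refl
  pathLength≡ (suc d) h = cong suc (trans (cong suc (pathLength≡ d h)) (cong (ℕ._+ h) (sym (ℕ.+-suc d d))))

  pathLength-half : ∀ d → pathLength d 0 ∸ pathLength d 0 / 2 ≡ d
  pathLength-half d = begin
    pathLength d 0 ∸ pathLength d 0 / 2 ≡⟨ cong (λ n → n ∸ n / 2) (trans (pathLength≡ d 0) (ℕ-ring d)) ⟩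
    d ℕ.* 2 ∸ d ℕ.* 2 / 2               ≡⟨ cong (d ℕ.* 2 ∸_) (m*n/n≡m d 2) ⟩
    d ℕ.* 2 ∸ d                         ≡⟨ cong (_∸ d) (ℕ.*-comm d 2) ⟩
    d ℕ.+ (d ℕ.+ 0) ∸ d                 ≡⟨ ℕ.m+n∸m≡n d (d ℕ.+ 0) ⟩
    d ℕ.+ 0                             ≡⟨ ℕ.+-identityʳ d ⟩
    d ∎
    where
    ℕ-ring : ∀ d → d ℕ.+ d ℕ.+ 0 ≡ d ℕ.* 2
    ℕ-ring = ℕ-Solver.solve-∀

  module _ (q : ℤ) where

    up-vanishes : ∀ n h r → n < h → up q n h r ≡ + 0
    down-vanishes : ∀ n h r → n < h → down q n h r ≡ + 0

    up-vanishes zero    (suc h)       r _ = refl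
    up-vanishes (suc n) (suc (suc h)) r (s≤s n<h) =
      trans (up-suc-high q n h r)
            (trans (cong₂ (λ u v → u + q ^ n * v) (up-vanishes n (suc h) r n<h) (down-vanishes n (suc h) r n<h))
                   (trans (+-identityˡ _) (*-zeroʳ (q ^ n))))

    down-vanishes zero    (suc h) r _ = refl
    down-vanishes (suc n) h       r n<h =
      trans (down-suc q n h r) (cong₂ _+_ (up-vanishes n (suc h) r n<1+h) (down-vanishes n (suc h) r n<1+h))
      where
      n<1+h : n < suc h
      n<1+h = ℕ.m≤n⇒m≤1+n (ℕ.<⇒≤ n<h)

    down-closed : ∀ d h r → down q (pathLength d h) h r ≡ downClosed q d h r
    up-closed : ∀ d h r → up q (suc (pathLength d h)) (suc h) r ≡ upClosed q d h r
    up-closed₀ : ∀ d r → up q (pathLength d 0) 0 r ≡ upClosed₀ d r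

    down-closed zero    zero    r = sym (downClosed-0 q 0 0 r (ℕ.0∸n≡0 r))
    down-closed zero    (suc h) r = begin
      down q (suc h) (suc h) r                              ≡⟨ down-suc q h (suc h) r ⟩
      up q h (suc (suc h)) r + down q h (suc (suc h)) r     ≡⟨ cong₂ _+_ (up-vanishes h _ r h<2+h) (down-vanishes h _ r h<2+h) ⟩
      + 0                                                   ≡⟨ downClosed-0 q 0 (suc h) r (ℕ.0∸n≡0 r) ⟨
      downClosed q 0 (suc h) r ∎
      where
      h<2+h : h < suc (suc h)
      h<2+h = ℕ.m<n⇒m<1+n (ℕ.n<1+n h)
    down-closed (suc d) h       r = begin
      down q (suc (suc (pathLength d h))) h r
        ≡⟨ down-suc q (suc (pathLength d h)) h r ⟩
      up q (suc (pathLength d h)) (suc h) r + down q (suc (pathLength d h)) (suc h) r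
        ≡⟨ cong₂ _+_ (up-closed d h r) (trans (cong (λ n → down q n (suc h) r) (sym (pathLength-suc d h))) (down-closed d (suc h) r)) ⟩
      upClosed q d h r + downClosed q d (suc h) r
        ≡⟨ downClosed-step q d h r ⟨
      downClosed q (suc d) h r ∎

    up-closed d zero r = begin
      up q (suc n) 1 r
        ≡⟨ up-suc-one q n r ⟩
      up q n 0 r + q ^ n * down q n 0 r + q ^ (n ∸ n / 2) * down q n 0 (r ∸ 1)
        ≡⟨ cong₂ _+_ (cong₂ (λ u v → u + q ^ n * v) (up-closed₀ d r) (down-closed d 0 r))
                     (cong₂ (λ e v → q ^ e * v) (pathLength-half d) (down-closed d 0 (r ∸ 1))) ⟩
      upClosed₀ d r + q ^ n * downClosed q d 0 r + q ^ d * downClosed q d 0 (r ∸ 1)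
        ≡⟨ cong (λ e → upClosed₀ d r + q ^ e * downClosed q d 0 r + q ^ d * downClosed q d 0 (r ∸ 1))
                (trans (pathLength≡ d 0) (ℕ.+-identityʳ (d ℕ.+ d))) ⟩
      upClosed₀ d r + q ^ (d ℕ.+ d) * downClosed q d 0 r + q ^ d * downClosed q d 0 (r ∸ 1)
        ≡⟨ upClosed-axis q d r ⟨
      upClosed q d 0 r ∎
      where n = pathLength d 0
    up-closed d (suc h) r = begin
      up q (suc (pathLength d (suc h))) (suc (suc h)) r
        ≡⟨ cong (λ n → up q (suc n) (suc (suc h)) r) (pathLength-suc d h) ⟩
      up q (suc (suc n)) (suc (suc h)) r
        ≡⟨ up-suc-high q (suc n) h r ⟩
      up q (suc n) (suc h) r + q ^ suc n * down q (suc n) (suc h) r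
        ≡⟨ cong₂ (λ u v → u + q ^ suc n * v) (up-closed d h r)
                 (trans (cong (λ n → down q n (suc h) r) (sym (pathLength-suc d h))) (down-closed d (suc h) r)) ⟩
      upClosed q d h r + q ^ suc n * downClosed q d (suc h) r
        ≡⟨ cong (λ e → upClosed q d h r + q ^ e * downClosed q d (suc h) r)
                (trans (sym (pathLength-suc d h)) (pathLength≡ d (suc h))) ⟩
      upClosed q d h r + q ^ (d ℕ.+ d ℕ.+ suc h) * downClosed q d (suc h) r
        ≡⟨ upClosed-step q d h r ⟨
      upClosed q d (suc h) r ∎
      where n = pathLength d h

    up-closed₀ zero    zero    = refl
    up-closed₀ zero    (suc r) = refl
    up-closed₀ (suc d) zero    = up-suc-zero q (suc (pathLength d 0)) zero
    up-closed₀ (suc d) (suc r) = up-suc-zero q (suc (pathLength d 0)) (suc r)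

    summand : ℕ → MarkedPath → ℤ
    summand r D = ind (isDyck (proj₁ D) ∧ marksValid (proj₁ D) (proj₂ D) ∧ (r ≤ᵇ countMarks (proj₂ D))) (q ^ vmr D)

    -- The vertex at x = 2s is not a valley, so it is never marked.
    summand-marked : ∀ r w m → length m ≡ length w → summand r (w , m ∷ʳ true) ≡ + 0
    summand-marked r w m ∣m∣ =
      trans (cong (λ v → ind (isDyck w ∧ v ∧ (r ≤ᵇ countMarks (m ∷ʳ true))) (q ^ vmr (w , m ∷ʳ true))) unmarkable)
            (cong (λ c → ind c (q ^ vmr (w , m ∷ʳ true))) (∧-zeroʳ (isDyck w)))
      where
      unmarkable : marksValid w (m ∷ʳ true) ≡ false
      unmarkable = begin
        marksValid w (m ∷ʳ true)                  ≡⟨ marksValid-∷ʳ w m true ⟩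
        marksValid w m ∧ returnAt w (length m)    ≡⟨ cong (λ i → marksValid w m ∧ returnAt w i) ∣m∣ ⟩
        marksValid w m ∧ returnAt w (length w)    ≡⟨ cong (marksValid w m ∧_) (returnAt-length w) ⟩
        marksValid w m ∧ false                    ≡⟨ ∧-zeroʳ (marksValid w m) ⟩
        false ∎

    summand-unmarked : ∀ r w m → summand r (w , m ∷ʳ false) ≡ summand r (w , m)
    summand-unmarked r w m
      rewrite marksValid-∷ʳ w m false | ∧-identityʳ (marksValid w m)
            | countMarks-∷ʳ m false   | ℕ.+-identityʳ (countMarks m)
            | halfMarked-∷ʳ m false   | ℕ.+-identityʳ (halfMarked m) = refl

    -- A nonempty Dyck path ends with a down-step.
    summand≡endingDown : ∀ r w m → 1 ≤ length w → summand r (w , m) ≡ endingDown q 0 r (statsOf w m)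
    summand≡endingDown r (b ∷ w) m _ =
      trans (byDyck (dyckFrom 0 (b ∷ w)) (dyckFrom-lastStep 0 b w))
            (cong (λ c → ind c (ind (not (lastStep (b ∷ w))) (markWeight q r (statsOf (b ∷ w) m)))) (dyckFrom-endHeight 0 (b ∷ w)))
      where
      byDyck : ∀ c → (c ≡ true → lastStep (b ∷ w) ≡ false) →
               ind (c ∧ valid (statsOf (b ∷ w) m) ∧ (r ≤ᵇ countMarks m)) (q ^ vmr (b ∷ w , m))
               ≡ ind c (ind (not (lastStep (b ∷ w))) (markWeight q r (statsOf (b ∷ w) m)))
      byDyck false _    = refl
      byDyck true  last rewrite last refl = refl

    vmrSum-down : ∀ s r → 1 ≤ s → vmrSum s r q ≡ down q (2 ℕ.* s) 0 r
    vmrSum-down s r 1≤s = begin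
      vmrSum s r q
        ≡⟨ sumℤ-filterᵇ _ (λ D → q ^ vmr D) (concatMap pairs (allLists n)) ⟩
      sumℤ (map (summand r) (concatMap pairs (allLists n)))
        ≡⟨ sumℤ-concatMap (summand r) pairs (allLists n) ⟩
      sumAll n (λ w → sumℤ (map (summand r) (pairs w)))
        ≡⟨ sumAll-cong n (λ w _ → cong sumℤ (sym (map-∘ (allLists (suc n))))) ⟩
      sumAll n (λ w → sumAll (suc n) (λ m → summand r (w , m)))
        ≡⟨ sumAll-cong n (λ w _ → sumAll-∷ʳ n _) ⟩
      sumAll² n (λ w m → summand r (w , m ∷ʳ true) + summand r (w , m ∷ʳ false))
        ≡⟨ sumAll²-cong n (λ w m ∣w∣ ∣m∣ →
             trans (cong₂ _+_ (summand-marked r w m (trans ∣m∣ (sym ∣w∣)))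
                              (trans (summand-unmarked r w m) (summand≡endingDown r w m (nonempty w ∣w∣))))
                   (+-identityˡ _)) ⟩
      down q n 0 r ∎
      where
      n = 2 ℕ.* s
      pairs : List Bool → List MarkedPath
      pairs w = map (w ,_) (allLists (suc n))
      nonempty : ∀ (w : List Bool) → length w ≡ n → 1 ≤ length w
      nonempty w ∣w∣ = subst (1 ≤_) (sym ∣w∣) (ℕ.≤-trans 1≤s (ℕ.m≤m+n s _))

    vmrSum-closed : ∀ s r → 1 ≤ s → vmrSum s r q ≡ downClosed q s 0 r
    vmrSum-closed s r 1≤s =
      trans (vmrSum-down s r 1≤s) (trans (cong (λ n → down q n 0 r) length≡) (down-closed s 0 r))
      where
      length≡ : 2 ℕ.* s ≡ pathLength s 0
      length≡ = trans (ℕ-ring s) (sym (pathLength≡ s 0))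
        where
        ℕ-ring : ∀ s → 2 ℕ.* s ≡ s ℕ.+ s ℕ.+ 0
        ℕ-ring = ℕ-Solver.solve-∀

open ClosedForms
open Enumeration
open import Data.Nat using (ℕ; _+_; _*_; _∸_; _≤_)
open import Data.Nat.Combinatorics using (_C_)
open import Data.Integer using (_^_)

lemma2p3 : (s : ℕ) → 1 ≤ s → (r : ℕ) →
    EqScaledQBinom (vmrSum s r) (λ q → q ^ ((r + 1) C 2)) (2 * s ∸ 1) (s + r)
lemma2p3 s 1≤s r =
  EqScaledQBinom-cong (λ q → vmrSum-closed q s r 1≤s)
                      (λ q → cong (q ^_) (sym (triangle≡C r)))
                      (downClosed-eqScaled s 1≤s r)
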